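{- Let $R$ be a nonzero finite commutative ring with identity, written as a finite direct product $R\cong\prod_i R_i$ of local rings, with $J$ the Jacobson radical of $R$, $J_i$ that of $R_i$, and $q_i=\frac{|R_i|}{|J_i|}$. Let $n\ge1$ and let $p_1,\dots,p_n$ be pairwise distant points of $\mathbb{P}(R)$. Then the cardinality $\cap n\mathrm{N}$ of the intersection of the neighbourhoods of $p_1,\dots,p_n$ is $$\cap n\mathrm{N}=|J|\sum_{k=0}^n(-1)^k\binom{n}{k}\prod_i(q_i+1-k).$$
   Context: For a ring $R$ with identity, $\mathbb{P}(R)$ is the set of submodules $R(a,b)\subseteq R^2$ where $(a,b)$ is the first row of some matrix in $\mathrm{GL}_2(R)$. Two such points $R(a,b)$, $R(c,d)$ are distant if $\begin{pmatrix}a&b\\c&d\end{pmatrix}\in\mathrm{GL}_2(R)$. The distant-set of a point is the set of points distant to it, and its neighbourhood is the complement (in $\mathbb{P}(R)$) of its distant-set. -}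

module Defs where

open import Level using (Level; 0ℓ)
open import Algebra.Bundles using (CommutativeRing)
open import Data.Nat as ℕ using (ℕ; zero; suc)
open import Data.Nat.Combinatorics using (_C_)
open import Data.Integer as ℤ using (ℤ; +_; -_; _^_)
open import Data.Fin using (Fin; zero; suc; toℕ)
open import Data.Product using (Σ; ∃; _×_; _,_)
open import Data.Sum using (_⊎_)
open import Data.Unit using (⊤)
open import Relation.Nullary using (¬_)
open import Relation.Binary.PropositionalEquality using (_≡_; _≢_)

CardOf : ∀ {a ℓ p} (A : Set a) (_~_ : A → A → Set ℓ) (P : A → Set p) → ℕ →
         Set (a Level.⊔ ℓ Level.⊔ p)
CardOf A _~_ P n =
  Σ (Fin n → A) λ xs →
    (∀ i → P (xs i)) ×
    (∀ i j → xs i ~ xs j → i ≡ j) ×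
    (∀ x → P x → ∃ λ i → x ~ xs i)

∑ : (n : ℕ) → (Fin n → ℤ) → ℤ
∑ zero    f = + 0
∑ (suc n) f = f zero ℤ.+ ∑ n (λ i → f (suc i))

∏ : (n : ℕ) → (Fin n → ℤ) → ℤ
∏ zero    f = + 1
∏ (suc n) f = f zero ℤ.* ∏ n (λ i → f (suc i))

module _ (R : CommutativeRing 0ℓ 0ℓ) where
  open CommutativeRing R

  Total : Carrier → Set
  Total _ = ⊤

  IsIdeal : (Carrier → Set) → Set
  IsIdeal I =
    (∀ {x y} → x ≈ y → I x → I y) ×
    I 0# ×
    (∀ {x y} → I x → I y → I (x + y)) ×
    (∀ r {x} → I x → I (r * x))

  IsMaximalIdeal : (Carrier → Set) → Set₁
  IsMaximalIdeal M =
    IsIdeal M ×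
    ¬ M 1# ×
    (∀ I → IsIdeal I → (∀ x → M x → I x) → (∀ x → I x → M x) ⊎ I 1#)

  Jacobson : Carrier → Set₁
  Jacobson x = ∀ M → IsMaximalIdeal M → M x

  IsLocal : Set₁
  IsLocal = Σ (Carrier → Set) λ M →
    IsMaximalIdeal M ×
    (∀ N → IsMaximalIdeal N → ∀ x → (N x → M x) × (M x → N x))

  IsFinite : Set
  IsFinite = ∃ λ N → CardOf Carrier _≈_ Total N

  InGL₂ : Carrier → Carrier → Carrier → Carrier → Set
  InGL₂ a b c d = Σ Carrier λ a' → Σ Carrier λ b' → Σ Carrier λ c' → Σ Carrier λ d' →
    (a * a' + b * c' ≈ 1#) × (a * b' + b * d' ≈ 0#) ×
    (c * a' + d * c' ≈ 0#) × (c * b' + d * d' ≈ 1#) ×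
    (a' * a + b' * c ≈ 1#) × (a' * b + b' * d ≈ 0#) ×
    (c' * a + d' * c ≈ 0#) × (c' * b + d' * d ≈ 1#)

  Pair : Set
  Pair = Carrier × Carrier

  Admissible : Pair → Set
  Admissible (a , b) = Σ Carrier λ c → Σ Carrier λ d → InGL₂ a b c d

  Distant : Pair → Pair → Set
  Distant (a , b) (c , d) = InGL₂ a b c d

  InSub : Pair → Pair → Set
  InSub (a , b) (x , y) = Σ Carrier λ r → (x ≈ r * a) × (y ≈ r * b)

  SameSub : Pair → Pair → Set
  SameSub p p' = ∀ v → (InSub p v → InSub p' v) × (InSub p' v → InSub p v)

  -- point (represented by an admissible pair) in the intersection of the
  -- neighbourhoods of the points represented by ps i
  InNbhdIntersection : ∀ {n} → (Fin n → Pair) → Pair → Set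
  InNbhdIntersection ps p = Admissible p × (∀ i → ¬ Distant (ps i) p)

module _ (R : CommutativeRing 0ℓ 0ℓ) {m : ℕ} (Rs : Fin m → CommutativeRing 0ℓ 0ℓ) where
  private module R = CommutativeRing R
  private module Rs i = CommutativeRing (Rs i)

  IsProductIso : (R.Carrier → (i : Fin m) → Rs.Carrier i) → Set
  IsProductIso φ =
    (∀ {x y} → x R.≈ y → ∀ i → Rs._≈_ i (φ x i) (φ y i)) ×
    (∀ x y i → Rs._≈_ i (φ (x R.+ y) i) (Rs._+_ i (φ x i) (φ y i))) ×
    (∀ x y i → Rs._≈_ i (φ (x R.* y) i) (Rs._*_ i (φ x i) (φ y i))) ×
    (∀ i → Rs._≈_ i (φ R.1# i) (Rs.1# i)) ×
    (∀ x y → (∀ i → Rs._≈_ i (φ x i) (φ y i)) → x R.≈ y) ×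
    (∀ (f : (i : Fin m) → Rs.Carrier i) → ∃ λ x → ∀ i → Rs._≈_ i (φ x i) (f i))

formula : (jR n m : ℕ) → (Fin m → ℕ) → ℤ
formula jR n m q =
  + jR ℤ.* ∑ (suc n) (λ k →
    ((- + 1) ^ toℕ k) ℤ.* (+ (n C toℕ k)) ℤ.*
    ∏ m (λ i → (+ q i) ℤ.+ + 1 ℤ.- + toℕ k))

-- Over a finite local ring S with maximal ideal M, where |S| = q |M|, the projective line
-- has |S| + |M| points, every point has exactly |M| neighbours, and non-distance is
-- transitive (a Plücker identity modulo M).  Hence the points distant from k pairwise
-- distant points number |M| (q + 1 − k).  The decomposition R ≅ ∏ Rᵢ acts coordinatewise
-- on points, on distance and on the Jacobson radical, so in R that number is
-- |J| ∏ᵢ (qᵢ + 1 − k).  Splitting the points by their distance to p₁, …, pₙ one at a time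
-- (inclusion–exclusion) yields the alternating sum.  The counting needs decidability
-- of arbitrary propositions; it comes from the maximal ideal of a local factor, since
-- maximality is a statement about all ideals.

module Submission where

open import Defs
open import Level using (0ℓ)
open import Algebra.Bundles using (CommutativeRing)
open import Axiom.ExcludedMiddle using (ExcludedMiddle)
open import Data.Nat as ℕ using (ℕ; zero; suc; _≤_; _<_; z≤n; s≤s)
import Data.Nat.Properties as ℕ
open import Data.Nat.Combinatorics using (_C_; nCk+nC[k+1]≡[n+1]C[k+1]; k>n⇒nCk≡0)
open import Data.Nat.Induction using (<-wellFounded)
open import Data.Integer as ℤ using (ℤ; +_; -[1+_]; _⊖_)
import Data.Integer.Properties as ℤ
open import Data.Integer.Tactic.RingSolver using (solve-∀)
open import Data.Fin as Fin using (Fin; zero; suc; toℕ)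
import Data.Fin.Properties as Fin
open import Data.Vec.Functional using (foldr)
open import Data.Product using (Σ; ∃; _×_; _,_; proj₁; proj₂; uncurry)
open import Data.Sum as Sum using (_⊎_; inj₁; inj₂; [_,_]′)
open import Data.Empty using (⊥; ⊥-elim)
open import Data.Unit using (tt)
open import Data.Maybe using (Maybe; just; nothing)
open import Data.List using (List; []; _∷_; length; map; tabulate)
import Data.List.Properties as List
open import Data.List.Relation.Unary.All as All using (All; []; _∷_)
import Data.List.Relation.Unary.All.Properties as All
open import Data.List.Relation.Unary.AllPairs as AllPairs using (AllPairs; []; _∷_)
import Data.List.Relation.Unary.AllPairs.Properties as AllPairs
open import Induction.WellFounded using (Acc; acc)
open import Relation.Nullary using (¬_; Dec; yes; no; ¬?; decidable-stable)
open import Relation.Binary using (IsEquivalence)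
open import Relation.Binary.PropositionalEquality as ≡ using (_≡_; _≢_)

-- The library's ring solvers take coefficients either in the ring itself, where zero
-- coefficients cannot be recognised, or in ℕ, which has no negation; so we supply ℤ.
module IntegerCoefficientSolver {c ℓ} (R : CommutativeRing c ℓ) where
  open CommutativeRing R
  open import Algebra.Properties.Ring ring using (-‿distribˡ-*; -‿distribʳ-*; -‿involutive; -0#≈0#; -‿+-comm)
  open import Algebra.Properties.Semiring.Mult.TCOptimised semiring using (×-homo-+; ×1-homo-*)
    renaming (_×_ to _·_)
  open import Algebra.Solver.Ring.AlmostCommutativeRing using (fromCommutativeRing; _-Raw-AlmostCommutative⟶_)
  open import Relation.Binary.Reasoning.Setoid setoid

  fromℤ : ℤ → Carrier
  fromℤ (+ n)    = n · 1#
  fromℤ -[1+ n ] = - (suc n · 1#)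

  fromℤ-neg : ∀ i → fromℤ (ℤ.- i) ≈ - fromℤ i
  fromℤ-neg (+ zero)  = sym -0#≈0#
  fromℤ-neg (+ suc n) = refl
  fromℤ-neg -[1+ n ]  = sym (-‿involutive _)

  fromℤ-⊖ : ∀ m n → fromℤ (m ⊖ n) ≈ m · 1# - n · 1#
  fromℤ-⊖ m zero = begin
    fromℤ (m ⊖ 0)        ≡⟨ ≡.cong fromℤ (≡.sym (ℤ.m-n≡m⊖n m 0)) ⟩
    fromℤ (+ m ℤ.+ + 0)  ≡⟨ ≡.cong fromℤ (ℤ.+-identityʳ (+ m)) ⟩
    m · 1#               ≈⟨ +-identityʳ _ ⟨
    m · 1# + 0#          ≈⟨ +-congˡ -0#≈0# ⟨
    m · 1# - 0#          ∎
  fromℤ-⊖ zero    (suc n) = sym (+-identityˡ _)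
  fromℤ-⊖ (suc m) (suc n) = begin
    fromℤ (suc m ⊖ suc n)                       ≡⟨ ≡.cong fromℤ (ℤ.[1+m]⊖[1+n]≡m⊖n m n) ⟩
    fromℤ (m ⊖ n)                               ≈⟨ fromℤ-⊖ m n ⟩
    m · 1# - n · 1#                             ≈⟨ +-congʳ (+-identityˡ _) ⟨
    (0# + m · 1#) - n · 1#                      ≈⟨ +-congʳ (+-congʳ (-‿inverseʳ 1#)) ⟨
    ((1# - 1#) + m · 1#) - n · 1#               ≈⟨ shuffle 1# (m · 1#) (n · 1#) ⟩
    (1# + m · 1#) - (1# + n · 1#)               ≈⟨ +-cong (×-homo-+ 1# 1 m) (-‿cong (×-homo-+ 1# 1 n)) ⟨
    suc m · 1# - suc n · 1#                     ∎
    where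
    shuffle : ∀ x y z → ((x - x) + y) - z ≈ (x + y) - (x + z)
    shuffle x y z = begin
      ((x - x) + y) - z   ≈⟨ +-congʳ (+-assoc x (- x) y) ⟩
      (x + (- x + y)) - z ≈⟨ +-congʳ (+-congˡ (+-comm (- x) y)) ⟩
      (x + (y - x)) - z   ≈⟨ +-congʳ (+-assoc x y (- x)) ⟨
      ((x + y) - x) - z   ≈⟨ +-assoc (x + y) (- x) (- z) ⟩
      (x + y) + (- x - z) ≈⟨ +-congˡ (-‿+-comm x z) ⟩
      (x + y) - (x + z)   ∎

  fromℤ-+ : ∀ i j → fromℤ (i ℤ.+ j) ≈ fromℤ i + fromℤ j
  fromℤ-+ (+ m)    (+ n)    = ×-homo-+ 1# m n
  fromℤ-+ (+ m)    -[1+ n ] = fromℤ-⊖ m (suc n)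
  fromℤ-+ -[1+ m ] (+ n)    = trans (fromℤ-⊖ n (suc m)) (+-comm _ _)
  fromℤ-+ -[1+ m ] -[1+ n ] = begin
    fromℤ (-[1+ m ] ℤ.+ -[1+ n ])         ≡⟨ ≡.cong fromℤ (ℤ.neg-distrib-+ (+ suc m) (+ suc n)) ⟨
    fromℤ (ℤ.- (+ suc m ℤ.+ + suc n))     ≈⟨ fromℤ-neg (+ suc m ℤ.+ + suc n) ⟩
    - fromℤ (+ suc m ℤ.+ + suc n)         ≈⟨ -‿cong (×-homo-+ 1# (suc m) (suc n)) ⟩
    - (suc m · 1# + suc n · 1#)           ≈⟨ -‿+-comm _ _ ⟨
    - (suc m · 1#) - suc n · 1#           ∎

  fromℤ-*-pos : ∀ m j → fromℤ (+ m ℤ.* j) ≈ m · 1# * fromℤ j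
  fromℤ-*-pos m (+ n) = begin
    fromℤ (+ m ℤ.* + n)   ≡⟨ ≡.cong fromℤ (ℤ.pos-* m n) ⟨
    (m ℕ.* n) · 1#        ≈⟨ ×1-homo-* m n ⟩
    m · 1# * n · 1#       ∎
  fromℤ-*-pos m -[1+ n ] = begin
    fromℤ (+ m ℤ.* ℤ.- + suc n)   ≡⟨ ≡.cong fromℤ (ℤ.neg-distribʳ-* (+ m) (+ suc n)) ⟨
    fromℤ (ℤ.- (+ m ℤ.* + suc n)) ≈⟨ fromℤ-neg (+ m ℤ.* + suc n) ⟩
    - fromℤ (+ m ℤ.* + suc n)     ≈⟨ -‿cong (fromℤ-*-pos m (+ suc n)) ⟩
    - (m · 1# * suc n · 1#)       ≈⟨ -‿distribʳ-* _ _ ⟩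
    m · 1# * - (suc n · 1#)       ∎

  fromℤ-* : ∀ i j → fromℤ (i ℤ.* j) ≈ fromℤ i * fromℤ j
  fromℤ-* (+ m)    j = fromℤ-*-pos m j
  fromℤ-* -[1+ m ] j = begin
    fromℤ (ℤ.- + suc m ℤ.* j)     ≡⟨ ≡.cong fromℤ (ℤ.neg-distribˡ-* (+ suc m) j) ⟨
    fromℤ (ℤ.- (+ suc m ℤ.* j))   ≈⟨ fromℤ-neg (+ suc m ℤ.* j) ⟩
    - fromℤ (+ suc m ℤ.* j)       ≈⟨ -‿cong (fromℤ-*-pos (suc m) j) ⟩
    - (suc m · 1# * fromℤ j)      ≈⟨ -‿distribˡ-* _ _ ⟩
    - (suc m · 1#) * fromℤ j      ∎

  homomorphism : ℤ.+-*-rawRing -Raw-AlmostCommutative⟶ fromCommutativeRing R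
  homomorphism = record
    { ⟦_⟧ = fromℤ ; +-homo = fromℤ-+ ; *-homo = fromℤ-* ; -‿homo = fromℤ-neg
    ; 0-homo = refl ; 1-homo = refl }

  coefficient-equality : ∀ i j → Maybe (fromℤ i ≈ fromℤ j)
  coefficient-equality i j with i ℤ.≟ j
  ... | yes ≡.refl = just refl
  ... | no _       = nothing

  open import Algebra.Solver.Ring ℤ.+-*-rawRing (fromCommutativeRing R) homomorphism coefficient-equality public

record Selection {q} (n : ℕ) (Q : Fin n → Set q) : Set q where
  field
    size            : ℕ
    index           : Fin size → Fin n
    index-satisfies : ∀ k → Q (index k)
    index-injective : ∀ {k k′} → index k ≡ index k′ → k ≡ k′
    index-covers    : ∀ i → Q i → ∃ λ k → index k ≡ i

select : ∀ {q} (n : ℕ) (Q : Fin n → Set q) → (∀ i → Dec (Q i)) → Selection n Q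
select zero    Q Q? = record
  { size = 0 ; index = λ () ; index-satisfies = λ () ; index-injective = λ {} ; index-covers = λ () }
select (suc n) Q Q? with Q? zero | select n (λ i → Q (suc i)) (λ i → Q? (suc i))
... | yes q₀ | S = record
  { size = suc size ; index = index′ ; index-satisfies = satisfies′
  ; index-injective = injective′ ; index-covers = covers′ }
  where
  open Selection S
  index′ : Fin (suc size) → Fin (suc n)
  index′ zero    = zero
  index′ (suc k) = suc (index k)
  satisfies′ : ∀ k → Q (index′ k)
  satisfies′ zero    = q₀
  satisfies′ (suc k) = index-satisfies k
  injective′ : ∀ {k k′} → index′ k ≡ index′ k′ → k ≡ k′
  injective′ {zero}  {zero}   _ = ≡.refl
  injective′ {suc k} {suc k′} e = ≡.cong suc (index-injective (Fin.suc-injective e))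
  covers′ : ∀ i → Q i → ∃ λ k → index′ k ≡ i
  covers′ zero    _  = zero , ≡.refl
  covers′ (suc i) qi with k , e ← index-covers i qi = suc k , ≡.cong suc e
... | no ¬q₀ | S = record
  { size = size ; index = λ k → suc (index k) ; index-satisfies = index-satisfies
  ; index-injective = λ e → index-injective (Fin.suc-injective e) ; index-covers = covers′ }
  where
  open Selection S
  covers′ : ∀ i → Q i → ∃ λ k → suc (index k) ≡ i
  covers′ zero    q₀ = ⊥-elim (¬q₀ q₀)
  covers′ (suc i) qi with k , e ← index-covers i qi = k , ≡.cong suc e

select-size-complement : ∀ {q} (n : ℕ) (Q : Fin n → Set q) (Q? : ∀ i → Dec (Q i)) →
  Selection.size (select n Q Q?) ℕ.+ Selection.size (select n (λ i → ¬ Q i) (λ i → ¬? (Q? i))) ≡ n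
select-size-complement zero    Q Q? = ≡.refl
select-size-complement (suc n) Q Q? with Q? zero
... | yes _ = ≡.cong suc (select-size-complement n _ (λ i → Q? (suc i)))
... | no  _ = ≡.trans (ℕ.+-suc _ _) (≡.cong suc (select-size-complement n _ (λ i → Q? (suc i))))

module _ {a ℓ} {A : Set a} {_~_ : A → A → Set ℓ} (~-equivalence : IsEquivalence _~_) where
  open IsEquivalence ~-equivalence renaming (sym to ~-sym; trans to ~-trans)

  CardOf-≤ : ∀ {p} {P : A → Set p} {n n′} → CardOf A _~_ P n → CardOf A _~_ P n′ → n ℕ.≤ n′
  CardOf-≤ {n = n} {n′} (xs , xs-P , xs-inj , xs-cover) (ys , _ , _ , ys-cover) =
    Fin.injective⇒≤ {f = position} position-injective
    where
    position : Fin n → Fin n′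
    position i = proj₁ (ys-cover (xs i) (xs-P i))
    position-injective : ∀ {i i′} → position i ≡ position i′ → i ≡ i′
    position-injective {i} {i′} e = xs-inj i i′ (~-trans (proj₂ (ys-cover (xs i) (xs-P i)))
      (≡.subst (λ k → ys k ~ xs i′) (≡.sym e) (~-sym (proj₂ (ys-cover (xs i′) (xs-P i′))))))

  CardOf-unique : ∀ {p} {P : A → Set p} {n n′} → CardOf A _~_ P n → CardOf A _~_ P n′ → n ≡ n′
  CardOf-unique c c′ = ℕ.≤-antisym (CardOf-≤ c c′) (CardOf-≤ c′ c)

  CardOf-cong : ∀ {p p′} {P : A → Set p} {P′ : A → Set p′} {n} →
    (∀ x → P x → P′ x) → (∀ x → P′ x → P x) → CardOf A _~_ P n → CardOf A _~_ P′ n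
  CardOf-cong to from (xs , xs-P , xs-inj , xs-cover) =
    xs , (λ i → to _ (xs-P i)) , xs-inj , (λ x p′x → xs-cover x (from x p′x))

  CardOf-partition : ∀ {p d} {P : A → Set p} {D : A → Set d} {n} →
    (∀ x → Dec (D x)) → (∀ x y → P x → P y → x ~ y → D x → D y) → CardOf A _~_ P n →
    ∃ λ k → ∃ λ k′ →
      CardOf A _~_ (λ x → P x × D x) k × CardOf A _~_ (λ x → P x × ¬ D x) k′ × k ℕ.+ k′ ≡ n
  CardOf-partition {P = P} {D} {n} D? D-resp (xs , xs-P , xs-inj , xs-cover) =
    In.size , Out.size , restrict In.index In.index-satisfies In.index-injective cover-in ,
    restrict Out.index Out.index-satisfies Out.index-injective cover-out ,
    select-size-complement n (λ i → D (xs i)) (λ i → D? (xs i))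
    where
    module In  = Selection (select n (λ i → D (xs i)) (λ i → D? (xs i)))
    module Out = Selection (select n (λ i → ¬ D (xs i)) (λ i → ¬? (D? (xs i))))
    restrict : ∀ {e} {E : A → Set e} {s} (g : Fin s → Fin n) → (∀ k → E (xs (g k))) →
      (∀ {k k′} → g k ≡ g k′ → k ≡ k′) → (∀ x → P x × E x → ∃ λ k → x ~ xs (g k)) →
      CardOf A _~_ (λ x → P x × E x) s
    restrict g g-E g-inj cover =
      (λ k → xs (g k)) , (λ k → xs-P (g k) , g-E k) , (λ k k′ e → g-inj (xs-inj _ _ e)) , cover
    cover-in : ∀ x → P x × D x → ∃ λ k → x ~ xs (In.index k)
    cover-in x (px , dx) with i , x~xsi ← xs-cover x px
      with k , ≡.refl ← In.index-covers i (D-resp x (xs i) px (xs-P i) x~xsi dx) = k , x~xsi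
    cover-out : ∀ x → P x × ¬ D x → ∃ λ k → x ~ xs (Out.index k)
    cover-out x (px , ¬dx) with i , x~xsi ← xs-cover x px
      with k , ≡.refl ← Out.index-covers i (λ dxi → ¬dx (D-resp (xs i) x (xs-P i) px (~-sym x~xsi) dxi))
      = k , x~xsi

  CardOf-⊎ : ∀ {p q} {P : A → Set p} {Q : A → Set q} {n n′} →
    (∀ x y → P x → Q y → ¬ (x ~ y)) →
    CardOf A _~_ P n → CardOf A _~_ Q n′ → CardOf A _~_ (λ x → P x ⊎ Q x) (n ℕ.+ n′)
  CardOf-⊎ {P = P} {Q} {n} {n′} disjoint (xs , xs-P , xs-inj , xs-cover) (ys , ys-Q , ys-inj , ys-cover) =
    zs , zs-PQ , zs-inj , zs-cover
    where
    zs : Fin (n ℕ.+ n′) → A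
    zs i = [ xs , ys ]′ (Fin.splitAt n i)
    zs-PQ : ∀ i → P (zs i) ⊎ Q (zs i)
    zs-PQ i with Fin.splitAt n i
    ... | inj₁ k = inj₁ (xs-P k)
    ... | inj₂ k = inj₂ (ys-Q k)
    splitAt-injective : ∀ i i′ → Fin.splitAt n i ≡ Fin.splitAt n i′ → i ≡ i′
    splitAt-injective i i′ e = ≡.trans (≡.sym (Fin.join-splitAt n n′ i))
      (≡.trans (≡.cong (Fin.join n n′) e) (Fin.join-splitAt n n′ i′))
    zs-inj : ∀ i i′ → zs i ~ zs i′ → i ≡ i′
    zs-inj i i′ e with Fin.splitAt n i in eq | Fin.splitAt n i′ in eq′
    ... | inj₁ k | inj₁ k′ = splitAt-injective i i′ (≡.trans eq (≡.trans (≡.cong inj₁ (xs-inj k k′ e)) (≡.sym eq′)))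
    ... | inj₂ k | inj₂ k′ = splitAt-injective i i′ (≡.trans eq (≡.trans (≡.cong inj₂ (ys-inj k k′ e)) (≡.sym eq′)))
    ... | inj₁ k | inj₂ k′ = ⊥-elim (disjoint _ _ (xs-P k) (ys-Q k′) e)
    ... | inj₂ k | inj₁ k′ = ⊥-elim (disjoint _ _ (xs-P k′) (ys-Q k) (~-sym e))
    zs-cover : ∀ x → P x ⊎ Q x → ∃ λ i → x ~ zs i
    zs-cover x (inj₁ px) with k , e ← xs-cover x px =
      k Fin.↑ˡ n′ , ≡.subst (λ s → x ~ [ xs , ys ]′ s) (≡.sym (Fin.splitAt-↑ˡ n k n′)) e
    zs-cover x (inj₂ qx) with k , e ← ys-cover x qx =
      n Fin.↑ʳ k , ≡.subst (λ s → x ~ [ xs , ys ]′ s) (≡.sym (Fin.splitAt-↑ʳ n n′ k)) e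

CardOf-transport : ∀ {a ℓ b ℓ′ p q} {A : Set a} {_~_ : A → A → Set ℓ} {B : Set b} {_≈_ : B → B → Set ℓ′}
  {P : A → Set p} {Q : B → Set q} {n} →
  (∀ {x y z} → x ≈ y → y ≈ z → x ≈ z) → (f : A → B) →
  (∀ x → P x → Q (f x)) →
  (∀ x y → P x → P y → x ~ y → f x ≈ f y) →
  (∀ x y → P x → P y → f x ≈ f y → x ~ y) →
  (∀ z → Q z → ∃ λ x → P x × z ≈ f x) →
  CardOf A _~_ P n → CardOf B _≈_ Q n
CardOf-transport {_≈_ = _≈_} {Q = Q} ≈-trans f f-PQ f-resp f-inj f-surj (xs , xs-P , xs-inj , xs-cover) =
  (λ i → f (xs i)) , (λ i → f-PQ _ (xs-P i)) , (λ i j e → xs-inj i j (f-inj _ _ (xs-P i) (xs-P j) e)) , cover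
  where
  cover : ∀ z → Q z → ∃ λ i → z ≈ f (xs i)
  cover z qz with x , px , z≈fx ← f-surj z qz with i , x~xsi ← xs-cover x px =
    i , ≈-trans z≈fx (f-resp _ _ px (xs-P i) x~xsi)

∏ℕ : ∀ {m} → (Fin m → ℕ) → ℕ
∏ℕ = foldr ℕ._*_ 1

CardOf-Π : ∀ {b ℓ p} (m : ℕ) {B : Fin m → Set b} {_~_ : ∀ i → B i → B i → Set ℓ} {P : ∀ i → B i → Set p}
  {n : Fin m → ℕ} → (∀ i → CardOf (B i) (_~_ i) (P i) (n i)) →
  CardOf ((i : Fin m) → B i) (λ t t′ → ∀ i → _~_ i (t i) (t′ i)) (λ t → ∀ i → P i (t i)) (∏ℕ n)
CardOf-Π zero    cards = (λ _ ()) , (λ _ ()) , (λ { zero zero _ → ≡.refl }) , (λ _ _ → zero , λ ())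
CardOf-Π (suc m) {B} {_~_} {P} {n} cards = zs , zs-P , zs-inj , zs-cover
  where
  xs = proj₁ (cards zero)
  tail = CardOf-Π m {B = λ i → B (suc i)} {λ i → _~_ (suc i)} {λ i → P (suc i)} (λ i → cards (suc i))
  ys = proj₁ tail
  N′ = ∏ℕ (λ i → n (suc i))
  cons : Fin (n zero) → Fin N′ → (i : Fin (suc m)) → B i
  cons k k′ zero    = xs k
  cons k k′ (suc i) = ys k′ i
  split : Fin (n zero ℕ.* N′) → Fin (n zero) × Fin N′
  split = Fin.remQuot N′
  join : Fin (n zero) × Fin N′ → Fin (n zero ℕ.* N′)
  join = uncurry Fin.combine
  zs : Fin (n zero ℕ.* N′) → (i : Fin (suc m)) → B i
  zs r = uncurry cons (split r)
  zs-P : ∀ r i → P i (zs r i)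
  zs-P r zero    = proj₁ (proj₂ (cards zero)) _
  zs-P r (suc i) = proj₁ (proj₂ tail) _ i
  cons-injective : ∀ {k l k′ l′} → (∀ i → _~_ i (cons k k′ i) (cons l l′ i)) → (k , k′) ≡ (l , l′)
  cons-injective {k} {l} {k′} {l′} e
    with ≡.refl ← proj₁ (proj₂ (proj₂ (cards zero))) k l (e zero)
    with ≡.refl ← proj₁ (proj₂ (proj₂ tail)) k′ l′ (λ i → e (suc i)) = ≡.refl
  zs-inj : ∀ r r′ → (∀ i → _~_ i (zs r i) (zs r′ i)) → r ≡ r′
  zs-inj r r′ e = begin
    r               ≡⟨ Fin.combine-remQuot {n zero} N′ r ⟨
    join (split r)  ≡⟨ ≡.cong join (cons-injective e) ⟩
    join (split r′) ≡⟨ Fin.combine-remQuot {n zero} N′ r′ ⟩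
    r′              ∎
    where open ≡.≡-Reasoning
  zs-cover : ∀ t → (∀ i → P i (t i)) → ∃ λ r → ∀ i → _~_ i (t i) (zs r i)
  zs-cover t pt
    with k , e ← proj₂ (proj₂ (proj₂ (cards zero))) (t zero) (pt zero)
    with k′ , e′ ← proj₂ (proj₂ (proj₂ tail)) (λ i → t (suc i)) (λ i → pt (suc i)) =
    join (k , k′) , λ i → ≡.subst (λ p → _~_ i (t i) (uncurry cons p i))
      (≡.sym (Fin.remQuot-combine {n zero} {N′} k k′)) (at i)
    where
    at : ∀ i → _~_ i (t i) (cons k k′ i)
    at zero    = e
    at (suc i) = e′ i

countWhere : (n : ℕ) (Q : Fin n → Set) → (∀ i → Dec (Q i)) → ℕ
countWhere zero    Q Q? = 0
countWhere (suc n) Q Q? with Q? zero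
... | yes _ = suc (countWhere n (λ i → Q (suc i)) (λ i → Q? (suc i)))
... | no  _ = countWhere n (λ i → Q (suc i)) (λ i → Q? (suc i))

countWhere-mono : (n : ℕ) {Q Q′ : Fin n → Set} (Q? : ∀ i → Dec (Q i)) (Q′? : ∀ i → Dec (Q′ i)) →
  (∀ i → Q i → Q′ i) → countWhere n Q Q? ≤ countWhere n Q′ Q′?
countWhere-mono zero    Q? Q′? Q⊆Q′ = z≤n
countWhere-mono (suc n) Q? Q′? Q⊆Q′ with Q? zero | Q′? zero
... | yes _  | yes _   = s≤s (countWhere-mono n _ _ (λ i → Q⊆Q′ (suc i)))
... | yes q  | no ¬q′  = ⊥-elim (¬q′ (Q⊆Q′ zero q))
... | no  _  | yes _   = ℕ.m≤n⇒m≤1+n (countWhere-mono n _ _ (λ i → Q⊆Q′ (suc i)))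
... | no  _  | no  _   = countWhere-mono n _ _ (λ i → Q⊆Q′ (suc i))

countWhere-strictMono : (n : ℕ) {Q Q′ : Fin n → Set} (Q? : ∀ i → Dec (Q i)) (Q′? : ∀ i → Dec (Q′ i)) →
  (∀ i → Q i → Q′ i) → (k : Fin n) → Q′ k → ¬ Q k → countWhere n Q Q? < countWhere n Q′ Q′?
countWhere-strictMono (suc n) Q? Q′? Q⊆Q′ zero q′ ¬q with Q? zero | Q′? zero
... | yes q | _      = ⊥-elim (¬q q)
... | no  _ | yes _  = s≤s (countWhere-mono n _ _ (λ i → Q⊆Q′ (suc i)))
... | no  _ | no ¬q′ = ⊥-elim (¬q′ q′)
countWhere-strictMono (suc n) Q? Q′? Q⊆Q′ (suc k) q′ ¬q with Q? zero | Q′? zero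
... | yes _ | yes _  = s≤s (countWhere-strictMono n _ _ (λ i → Q⊆Q′ (suc i)) k q′ ¬q)
... | yes q | no ¬q′ = ⊥-elim (¬q′ (Q⊆Q′ zero q))
... | no  _ | yes _  = ℕ.m≤n⇒m≤1+n (countWhere-strictMono n _ _ (λ i → Q⊆Q′ (suc i)) k q′ ¬q)
... | no  _ | no  _  = countWhere-strictMono n _ _ (λ i → Q⊆Q′ (suc i)) k q′ ¬q

module ProjectiveLine (R : CommutativeRing 0ℓ 0ℓ) where
  open CommutativeRing R
  open IntegerCoefficientSolver R
  open import Algebra.Properties.Ring ring using (-0#≈0#)
  open import Algebra.Properties.Group +-group using (x∙y⁻¹≈ε⇒x≈y; x≈y⇒x∙y⁻¹≈ε)
  open import Relation.Binary.Reasoning.Setoid setoid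

  det : Pair R → Pair R → Carrier
  det (a , b) (c , d) = a * d - b * c

  IsUnit : Carrier → Set
  IsUnit x = ∃ λ y → x * y ≈ 1#

  Unimodular : Pair R → Set
  Unimodular (a , b) = ∃ λ s → ∃ λ t → a * s + b * t ≈ 1#

  IsUnit-resp : ∀ {x y} → x ≈ y → IsUnit x → IsUnit y
  IsUnit-resp x≈y (u , xu≈1) = u , trans (*-congʳ (sym x≈y)) xu≈1

  IsUnit-neg : ∀ {x} → IsUnit x → IsUnit (- x)
  IsUnit-neg {x} (u , xu≈1) = - u , trans (solve 2 (λ x u → (:- x) :* (:- u) := x :* u) refl x u) xu≈1

  IsUnit-factorʳ : ∀ {x y} → IsUnit (x * y) → IsUnit y
  IsUnit-factorʳ {x} {y} (u , xyu≈1) = x * u , trans (solve 3 (λ x y u → y :* (x :* u) := x :* y :* u) refl x y u) xyu≈1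

  InGL₂⇒IsUnit-det : ∀ {a b c d} → InGL₂ R a b c d → IsUnit (det (a , b) (c , d))
  InGL₂⇒IsUnit-det {a} {b} {c} {d} (a′ , b′ , c′ , d′ , e₁ , e₂ , e₃ , e₄ , _) = a′ * d′ - b′ * c′ , (begin
    (a * d - b * c) * (a′ * d′ - b′ * c′)
      ≈⟨ solve 8 (λ a b c d a′ b′ c′ d′ →
           (a :* d :- b :* c) :* (a′ :* d′ :- b′ :* c′) :=
           (a :* a′ :+ b :* c′) :* (c :* b′ :+ d :* d′) :- (a :* b′ :+ b :* d′) :* (c :* a′ :+ d :* c′))
           refl a b c d a′ b′ c′ d′ ⟩
    (a * a′ + b * c′) * (c * b′ + d * d′) - (a * b′ + b * d′) * (c * a′ + d * c′)
      ≈⟨ +-cong (*-cong e₁ e₄) (-‿cong (*-cong e₂ e₃)) ⟩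
    1# * 1# - 0# * 0#
      ≈⟨ solve 0 (con (+ 1) :* con (+ 1) :- con (+ 0) :* con (+ 0) := con (+ 1)) refl ⟩
    1# ∎)

  IsUnit-det⇒InGL₂ : ∀ {a b c d} → IsUnit (det (a , b) (c , d)) → InGL₂ R a b c d
  IsUnit-det⇒InGL₂ {a} {b} {c} {d} (y , Δy≈1) =
    d * y , - (b * y) , - (c * y) , a * y ,
    trans (solve 5 (λ a b c d y → a :* (d :* y) :+ b :* (:- (c :* y)) := Δ a b c d :* y) refl a b c d y) Δy≈1 ,
    solve 5 (λ a b c d y → a :* (:- (b :* y)) :+ b :* (a :* y) := con (+ 0)) refl a b c d y ,
    solve 5 (λ a b c d y → c :* (d :* y) :+ d :* (:- (c :* y)) := con (+ 0)) refl a b c d y ,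
    trans (solve 5 (λ a b c d y → c :* (:- (b :* y)) :+ d :* (a :* y) := Δ a b c d :* y) refl a b c d y) Δy≈1 ,
    trans (solve 5 (λ a b c d y → (d :* y) :* a :+ (:- (b :* y)) :* c := Δ a b c d :* y) refl a b c d y) Δy≈1 ,
    solve 5 (λ a b c d y → (d :* y) :* b :+ (:- (b :* y)) :* d := con (+ 0)) refl a b c d y ,
    solve 5 (λ a b c d y → (:- (c :* y)) :* a :+ (a :* y) :* c := con (+ 0)) refl a b c d y ,
    trans (solve 5 (λ a b c d y → (:- (c :* y)) :* b :+ (a :* y) :* d := Δ a b c d :* y) refl a b c d y) Δy≈1
    where
    Δ : ∀ {n} → Polynomial n → Polynomial n → Polynomial n → Polynomial n → Polynomial n
    Δ a b c d = a :* d :- b :* c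

  Distant⇒IsUnit-det : ∀ p q → Distant R p q → IsUnit (det p q)
  Distant⇒IsUnit-det (a , b) (c , d) = InGL₂⇒IsUnit-det

  IsUnit-det⇒Distant : ∀ p q → IsUnit (det p q) → Distant R p q
  IsUnit-det⇒Distant (a , b) (c , d) = IsUnit-det⇒InGL₂

  Admissible⇒Unimodular : ∀ p → Admissible R p → Unimodular p
  Admissible⇒Unimodular (a , b) (c , d , a′ , b′ , c′ , d′ , aa′+bc′≈1 , _) = a′ , c′ , aa′+bc′≈1

  det-complement : ∀ {a b s t} → a * s + b * t ≈ 1# → det (a , b) (- t , s) ≈ 1#
  det-complement {a} {b} {s} {t} as+bt≈1 =
    trans (solve 4 (λ a b s t → a :* s :- b :* (:- t) := a :* s :+ b :* t) refl a b s t) as+bt≈1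

  Unimodular⇒Admissible : ∀ p → Unimodular p → Admissible R p
  Unimodular⇒Admissible (a , b) (s , t , as+bt≈1) =
    - t , s , IsUnit-det⇒InGL₂ (1# , trans (*-identityʳ _) (det-complement as+bt≈1))

  det-antisym : ∀ p q → det q p ≈ - det p q
  det-antisym (a , b) (c , d) = solve 4 (λ a b c d → c :* b :- d :* a := :- (a :* d :- b :* c)) refl a b c d

  det-self : ∀ p → det p p ≈ 0#
  det-self (a , b) = solve 2 (λ a b → a :* b :- b :* a := con (+ 0)) refl a b

  det-congʳ : ∀ p {c d c′ d′} → c ≈ c′ → d ≈ d′ → det p (c , d) ≈ det p (c′ , d′)
  det-congʳ (a , b) c≈c′ d≈d′ = +-cong (*-congˡ d≈d′) (-‿cong (*-congˡ c≈c′))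

  det-cong : ∀ {a b c d a′ b′ c′ d′} → a ≈ a′ → b ≈ b′ → c ≈ c′ → d ≈ d′ →
    det (a , b) (c , d) ≈ det (a′ , b′) (c′ , d′)
  det-cong a≈a′ b≈b′ c≈c′ d≈d′ = +-cong (*-cong a≈a′ d≈d′) (-‿cong (*-cong b≈b′ c≈c′))

  Distant-sym : ∀ {p q} → Distant R p q → Distant R q p
  Distant-sym {p} {q} p#q = IsUnit-det⇒Distant q p
    (IsUnit-resp (sym (det-antisym p q)) (IsUnit-neg (Distant⇒IsUnit-det p q p#q)))

  InSub-refl : ∀ p → InSub R p p
  InSub-refl (a , b) = 1# , sym (*-identityˡ a) , sym (*-identityˡ b)

  InSub-trans : ∀ u v w → InSub R u v → InSub R v w → InSub R u w
  InSub-trans (a , b) (c , d) (e , f) (r , c≈ra , d≈rb) (s , e≈sc , f≈sd) =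
    s * r , trans e≈sc (trans (*-congˡ c≈ra) (sym (*-assoc s r a))) ,
            trans f≈sd (trans (*-congˡ d≈rb) (sym (*-assoc s r b)))

  SameSub-sym : ∀ {p q} → SameSub R p q → SameSub R q p
  SameSub-sym p≡q v = proj₂ (p≡q v) , proj₁ (p≡q v)

  SameSub-trans : ∀ {p q r} → SameSub R p q → SameSub R q r → SameSub R p r
  SameSub-trans p≡q q≡r v = (λ x → proj₁ (q≡r v) (proj₁ (p≡q v) x)) , (λ x → proj₂ (p≡q v) (proj₂ (q≡r v) x))

  Unimodular-resp : ∀ {a b a′ b′} → a ≈ a′ → b ≈ b′ → Unimodular (a , b) → Unimodular (a′ , b′)
  Unimodular-resp a≈a′ b≈b′ (s , t , as+bt≈1) = s , t , trans (+-cong (*-congʳ (sym a≈a′)) (*-congʳ (sym b≈b′))) as+bt≈1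

  ≈⇒SameSub : ∀ {a b a′ b′} → a ≈ a′ → b ≈ b′ → SameSub R (a , b) (a′ , b′)
  ≈⇒SameSub a≈a′ b≈b′ v =
    (λ (r , x≈ra , y≈rb) → r , trans x≈ra (*-congˡ a≈a′) , trans y≈rb (*-congˡ b≈b′)) ,
    (λ (r , x≈ra′ , y≈rb′) → r , trans x≈ra′ (*-congˡ (sym a≈a′)) , trans y≈rb′ (*-congˡ (sym b≈b′)))

  SameSub-isEquivalence : IsEquivalence (SameSub R)
  SameSub-isEquivalence = record
    { refl = λ _ → (λ v∈p → v∈p) , (λ v∈p → v∈p) ; sym = SameSub-sym ; trans = SameSub-trans }

  InSub⇒det≈0 : ∀ p q → InSub R p q → det p q ≈ 0#
  InSub⇒det≈0 (a , b) (c , d) (r , c≈ra , d≈rb) = begin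
    a * d - b * c             ≈⟨ det-cong refl refl c≈ra d≈rb ⟩
    a * (r * b) - b * (r * a) ≈⟨ solve 3 (λ a b r → a :* (r :* b) :- b :* (r :* a) := con (+ 0)) refl a b r ⟩
    0#                        ∎

  SameSub⇒det≈0 : ∀ p q → SameSub R p q → det p q ≈ 0#
  SameSub⇒det≈0 p q p≡q = InSub⇒det≈0 p q (proj₂ (p≡q q) (InSub-refl q))

  -- with a s + b t = 1, the multiplier taking (a , b) to (c , d) is c s + d t
  det≈0⇒InSub : ∀ p q → Unimodular p → det p q ≈ 0# → InSub R p q
  det≈0⇒InSub (a , b) (c , d) (s , t , as+bt≈1) ad-bc≈0 = c * s + d * t ,
    (begin
      c                                         ≈⟨ unimodular-scale c ⟩
      c * (a * s + b * t) + t * 0#              ≈⟨ +-congˡ (*-congˡ ad-bc≈0) ⟨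
      c * (a * s + b * t) + t * (a * d - b * c)
        ≈⟨ solve 6 (λ a b c d s t → c :* (a :* s :+ b :* t) :+ t :* (a :* d :- b :* c) := (c :* s :+ d :* t) :* a)
                   refl a b c d s t ⟩
      (c * s + d * t) * a                       ∎) ,
    (begin
      d                                         ≈⟨ unimodular-scale d ⟩
      d * (a * s + b * t) + (- s) * 0#          ≈⟨ +-congˡ (*-congˡ ad-bc≈0) ⟨
      d * (a * s + b * t) + (- s) * (a * d - b * c)
        ≈⟨ solve 6 (λ a b c d s t → d :* (a :* s :+ b :* t) :+ (:- s) :* (a :* d :- b :* c) := (c :* s :+ d :* t) :* b)
                   refl a b c d s t ⟩
      (c * s + d * t) * b                       ∎)
    where
    unimodular-scale : ∀ x {y} → x ≈ x * (a * s + b * t) + y * 0#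
    unimodular-scale x {y} = begin
      x                            ≈⟨ *-identityʳ x ⟨
      x * 1#                       ≈⟨ *-congˡ as+bt≈1 ⟨
      x * (a * s + b * t)          ≈⟨ +-identityʳ _ ⟨
      x * (a * s + b * t) + 0#     ≈⟨ +-congˡ (zeroʳ y) ⟨
      x * (a * s + b * t) + y * 0# ∎

  det≈0⇒SameSub : ∀ p q → Unimodular p → Unimodular q → det p q ≈ 0# → SameSub R p q
  det≈0⇒SameSub p q p-unimodular q-unimodular det≈0 v =
    InSub-trans q p v q∈p , InSub-trans p q v p∈q
    where
    p∈q : InSub R p q
    p∈q = det≈0⇒InSub p q p-unimodular det≈0
    q∈p : InSub R q p
    q∈p = det≈0⇒InSub q p q-unimodular (trans (det-antisym p q) (trans (-‿cong det≈0) -0#≈0#))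

  det-scaleʳ : ∀ p r c d → det p (r * c , r * d) ≈ r * det p (c , d)
  det-scaleʳ (a , b) r c d = solve 5 (λ a b c d r → a :* (r :* d) :- b :* (r :* c) := r :* (a :* d :- b :* c)) refl a b c d r

  Distant-respʳ-SameSub : ∀ p {q q′} → SameSub R q q′ → Distant R p q → Distant R p q′
  Distant-respʳ-SameSub p {q} {q′} q≡q′ p#q with r , c≈rc′ , d≈rd′ ← proj₁ (q≡q′ q) (InSub-refl q) =
    IsUnit-det⇒Distant p q′ (IsUnit-factorʳ (IsUnit-resp (trans (det-congʳ p c≈rc′ d≈rd′) (det-scaleʳ p r _ _))
      (Distant⇒IsUnit-det p q p#q)))

  line : Pair R → Pair R → Carrier → Pair R
  line (a , b) (c , d) t = a + t * c , b + t * d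

  det-line : ∀ p v x y → det (line p v x) (line p v y) ≈ (y - x) * det p v
  det-line (a , b) (c , d) x y = solve 6 (λ a b c d x y →
    (a :+ x :* c) :* (b :+ y :* d) :- (b :+ x :* d) :* (a :+ y :* c) := (y :- x) :* (a :* d :- b :* c)) refl a b c d x y

  det-base-line : ∀ p v t → det p (line p v t) ≈ t * det p v
  det-base-line (a , b) (c , d) t = solve 5 (λ a b c d t →
    a :* (b :+ t :* d) :- b :* (a :+ t :* c) := t :* (a :* d :- b :* c)) refl a b c d t

  Unimodular-line : ∀ p v → det p v ≈ 1# → ∀ t → Unimodular (line p v t)
  Unimodular-line (a , b) (c , d) ad-bc≈1 t = d , - c ,
    trans (solve 5 (λ a b c d t → (a :+ t :* c) :* d :+ (b :+ t :* d) :* (:- c) := a :* d :- b :* c) refl a b c d t) ad-bc≈1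

  CardOf-line : ∀ {P : Carrier → Set} {Q : Pair R → Set} {n} p v → det p v ≈ 1# →
    (∀ t → P t → Q (line p v t)) → (∀ z → Q z → ∃ λ t → P t × SameSub R z (line p v t)) →
    CardOf Carrier _≈_ P n → CardOf (Pair R) (SameSub R) Q n
  CardOf-line p v det≈1 P⇒Q Q⇒P = CardOf-transport {_~_ = _≈_} {_≈_ = SameSub R} SameSub-trans (line p v) P⇒Q
    (λ x y _ _ x≈y → det≈0⇒SameSub _ _ (unimodular x) (unimodular y)
      (trans (det-line′ x y) (x≈y⇒x∙y⁻¹≈ε (sym x≈y))))
    (λ x y _ _ x≡y → sym (x∙y⁻¹≈ε⇒x≈y y x (trans (sym (det-line′ x y)) (SameSub⇒det≈0 _ _ x≡y))))
    Q⇒P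
    where
    unimodular : ∀ t → Unimodular (line p v t)
    unimodular = Unimodular-line p v det≈1
    det-line′ : ∀ x y → det (line p v x) (line p v y) ≈ y - x
    det-line′ x y = trans (det-line p v x y) (trans (*-congˡ det≈1) (*-identityʳ _))

  DistantToAll : List (Pair R) → Pair R → Set
  DistantToAll ps y = Admissible R y × All (λ p → Distant R p y) ps

module Ideals (R : CommutativeRing 0ℓ 0ℓ) where
  open CommutativeRing R
  open IntegerCoefficientSolver R
  open ProjectiveLine R using (IsUnit)

  -- Maximality quantifies over all ideals, in particular over M extended by
  -- the whole ring exactly when Q holds; that ideal decides Q.
  IsMaximalIdeal⇒ExcludedMiddle : ∀ {M} → IsMaximalIdeal R M → ExcludedMiddle 0ℓ
  IsMaximalIdeal⇒ExcludedMiddle {M} ((M-resp , M-0 , M-+ , M-*) , 1∉M , maximal) {Q}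
    with maximal (λ x → M x ⊎ Q) ideal (λ _ → inj₁)
    where
    ideal : IsIdeal R (λ x → M x ⊎ Q)
    ideal = (λ { x≈y (inj₁ m) → inj₁ (M-resp x≈y m) ; _ (inj₂ q) → inj₂ q }) ,
            inj₁ M-0 ,
            (λ { (inj₁ m) (inj₁ m′) → inj₁ (M-+ m m′) ; (inj₂ q) _ → inj₂ q ; _ (inj₂ q) → inj₂ q }) ,
            (λ { r (inj₁ m) → inj₁ (M-* r m) ; r (inj₂ q) → inj₂ q })
  ... | inj₁ back       = no λ q → 1∉M (back 1# (inj₂ q))
  ... | inj₂ (inj₁ 1∈M) = ⊥-elim (1∉M 1∈M)
  ... | inj₂ (inj₂ q)   = yes q

  Jacobson-resp : ∀ {x y} → x ≈ y → Jacobson R x → Jacobson R y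
  Jacobson-resp x≈y x∈J M M-maximal = proj₁ (proj₁ M-maximal) x≈y (x∈J M M-maximal)

  Principal : Carrier → Carrier → Set
  Principal x y = ∃ λ r → y ≈ r * x

  Principal-isIdeal : ∀ x → IsIdeal R (Principal x)
  Principal-isIdeal x =
    (λ y≈z (r , y≈rx) → r , trans (sym y≈z) y≈rx) ,
    (0# , sym (zeroˡ x)) ,
    (λ (r , y≈rx) (s , z≈sx) → r + s , trans (+-cong y≈rx z≈sx) (sym (distribʳ x r s))) ,
    (λ s (r , y≈rx) → s * r , trans (*-congˡ y≈rx) (sym (*-assoc s r x)))

  ¬IsUnit⇒1∉Principal : ∀ {x} → ¬ IsUnit x → ¬ Principal x 1#
  ¬IsUnit⇒1∉Principal {x} ¬unit (r , 1≈rx) = ¬unit (r , trans (*-comm x r) (sym 1≈rx))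

  Adjoin : (Carrier → Set) → Carrier → Carrier → Set
  Adjoin I x y = ∃ λ z → ∃ λ r → I z × y ≈ z + r * x

  module _ {I : Carrier → Set} (I-ideal : IsIdeal R I) where
    private
      I-0 : I 0#
      I-0 = proj₁ (proj₂ I-ideal)

      I-+ : ∀ {x y} → I x → I y → I (x + y)
      I-+ = proj₁ (proj₂ (proj₂ I-ideal))

      I-* : ∀ r {x} → I x → I (r * x)
      I-* = proj₂ (proj₂ (proj₂ I-ideal))

    Adjoin-isIdeal : ∀ x → IsIdeal R (Adjoin I x)
    Adjoin-isIdeal x =
      (λ y≈y′ (z , r , z∈I , y≈z+rx) → z , r , z∈I , trans (sym y≈y′) y≈z+rx) ,
      (0# , 0# , I-0 , solve 1 (λ x → con (+ 0) := con (+ 0) :+ con (+ 0) :* x) refl x) ,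
      (λ (z , r , z∈I , y≈) (z′ , r′ , z′∈I , y′≈) → z + z′ , r + r′ , I-+ z∈I z′∈I ,
         trans (+-cong y≈ y′≈) (solve 5 (λ z z′ r r′ x → (z :+ r :* x) :+ (z′ :+ r′ :* x) := (z :+ z′) :+ (r :+ r′) :* x)
                                 refl z z′ r r′ x)) ,
      (λ s (z , r , z∈I , y≈) → s * z , s * r , I-* s z∈I ,
         trans (*-congˡ y≈) (solve 4 (λ s z r x → s :* (z :+ r :* x) := s :* z :+ s :* r :* x) refl s z r x))

    I⊆Adjoin : ∀ x y → I y → Adjoin I x y
    I⊆Adjoin x y y∈I = y , 0# , y∈I , solve 2 (λ y x → y := y :+ con (+ 0) :* x) refl y x

    x∈Adjoin : ∀ x → Adjoin I x x
    x∈Adjoin x = 0# , 1# , I-0 , solve 1 (λ x → x := con (+ 0) :+ con (+ 1) :* x) refl x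

  module _ (em : ExcludedMiddle 0ℓ) where

    MaximalAbove : (Carrier → Set) → Set₁
    MaximalAbove I = ∃ λ M → IsMaximalIdeal R M × (∀ x → I x → M x)

    maximal-or-extensible : ∀ {I} → IsIdeal R I → ¬ I 1# →
      MaximalAbove I ⊎ ∃ λ x → ¬ I x × ¬ Adjoin I x 1#
    maximal-or-extensible {I} I-ideal 1∉I with em {∃ λ x → ¬ I x × ¬ Adjoin I x 1#}
    ... | yes extension = inj₂ extension
    ... | no ¬extension = inj₁ (I , (I-ideal , 1∉I , maximal) , λ _ x∈I → x∈I)
      where
      maximal : ∀ J → IsIdeal R J → (∀ x → I x → J x) → (∀ x → J x → I x) ⊎ J 1#
      maximal J (J-resp , _ , J-+ , J-*) I⊆J with em {∃ λ x → J x × ¬ I x}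
      ... | no ¬new = inj₁ λ x x∈J → decidable-stable em λ x∉I → ¬new (x , x∈J , x∉I)
      ... | yes (x , x∈J , x∉I) with em {Adjoin I x 1#}
      ...   | no 1∉I+x = ⊥-elim (¬extension (x , x∉I , 1∉I+x))
      ...   | yes (z , r , z∈I , 1≈z+rx) = inj₂ (J-resp (sym 1≈z+rx) (J-+ (I⊆J z z∈I) (J-* r x∈J)))

    module _ {N} (finite : CardOf Carrier _≈_ (Total R) N) where
      private
        element : Fin N → Carrier
        element = proj₁ finite

        position : ∀ x → ∃ λ i → x ≈ element i
        position x = proj₂ (proj₂ (proj₂ finite)) x tt

        outside : (Carrier → Set) → ℕ
        outside I = countWhere N (λ i → ¬ I (element i)) (λ _ → em)

        outside-Adjoin : ∀ {I} → IsIdeal R I → ∀ {x} → ¬ I x → outside (Adjoin I x) < outside I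
        outside-Adjoin {I} I-ideal {x} x∉I with i , x≈xᵢ ← position x =
          countWhere-strictMono N _ _ (λ j ∉I+x ∈I → ∉I+x (I⊆Adjoin I-ideal x _ ∈I)) i
            (λ xᵢ∈I → x∉I (proj₁ I-ideal (sym x≈xᵢ) xᵢ∈I))
            (λ xᵢ∉I+x → xᵢ∉I+x (proj₁ (Adjoin-isIdeal I-ideal x) x≈xᵢ (x∈Adjoin I-ideal x)))

        maximalAbove-acc : ∀ I → IsIdeal R I → ¬ I 1# → Acc _<_ (outside I) → MaximalAbove I
        maximalAbove-acc I I-ideal 1∉I (acc smaller) with maximal-or-extensible I-ideal 1∉I
        ... | inj₁ maximal = maximal
        ... | inj₂ (x , x∉I , 1∉I+x)
          with M , M-maximal , I+x⊆M ← maximalAbove-acc (Adjoin I x) (Adjoin-isIdeal I-ideal x) 1∉I+x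
                                         (smaller (outside-Adjoin I-ideal x∉I))
          = M , M-maximal , λ y y∈I → I+x⊆M y (I⊆Adjoin I-ideal x y y∈I)

      maximalAbove : ∀ I → IsIdeal R I → ¬ I 1# → MaximalAbove I
      maximalAbove I I-ideal 1∉I = maximalAbove-acc I I-ideal 1∉I (<-wellFounded (outside I))

      ¬IsUnit⇒InMaximal : ∀ {x} → ¬ IsUnit x → ∃ λ M → IsMaximalIdeal R M × M x
      ¬IsUnit⇒InMaximal {x} ¬unit
        with M , M-maximal , ⟨x⟩⊆M ← maximalAbove (Principal x) (Principal-isIdeal x) (¬IsUnit⇒1∉Principal ¬unit)
        = M , M-maximal , ⟨x⟩⊆M x (1# , sym (*-identityˡ x))

      Jacobson⇒IsUnit : ∀ {x} → Jacobson R x → ∀ r → IsUnit (1# - r * x)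
      Jacobson⇒IsUnit {x} x∈J r with em {IsUnit (1# - r * x)}
      ... | yes unit = unit
      ... | no ¬unit with M , M-maximal@((M-resp , _ , M-+ , M-*) , 1∉M , _) , 1-rx∈M ← ¬IsUnit⇒InMaximal ¬unit =
        ⊥-elim (1∉M (M-resp (solve 2 (λ r x → (con (+ 1) :- r :* x) :+ r :* x := con (+ 1)) refl r x)
                            (M-+ 1-rx∈M (M-* r (x∈J M M-maximal)))))

    IsUnit⇒Jacobson : ∀ {x} → (∀ r → IsUnit (1# - r * x)) → Jacobson R x
    IsUnit⇒Jacobson {x} units M (M-ideal@(M-resp , _ , _ , M-*) , 1∉M , maximal) with em {M x}
    ... | yes x∈M = x∈M
    ... | no  x∉M with maximal (Adjoin M x) (Adjoin-isIdeal M-ideal x) (I⊆Adjoin M-ideal x)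
    ...   | inj₁ M+x⊆M = ⊥-elim (x∉M (M+x⊆M x (x∈Adjoin M-ideal x)))
    ...   | inj₂ (z , r , z∈M , 1≈z+rx) with u , [1-rx]u≈1 ← units r =
      ⊥-elim (1∉M (M-resp uz≈1 (M-* u z∈M)))
      where
      uz≈1 : u * z ≈ 1#
      uz≈1 = trans (*-comm u z) (trans (*-congʳ z≈1-rx) [1-rx]u≈1)
        where
        z≈1-rx : z ≈ 1# - r * x
        z≈1-rx = trans (solve 3 (λ z r x → z := (z :+ r :* x) :- r :* x) refl z r x) (+-congʳ (sym 1≈z+rx))

module LocalRing (S : CommutativeRing 0ℓ 0ℓ) (local : IsLocal S) where
  open CommutativeRing S
  open IntegerCoefficientSolver S
  open ProjectiveLine S
  open Ideals S

  M : Carrier → Set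
  M = proj₁ local

  private
    M-maximal : IsMaximalIdeal S M
    M-maximal = proj₁ (proj₂ local)

    M-resp : ∀ {x y} → x ≈ y → M x → M y
    M-resp = proj₁ (proj₁ M-maximal)

    M-+ : ∀ {x y} → M x → M y → M (x + y)
    M-+ = proj₁ (proj₂ (proj₂ (proj₁ M-maximal)))

    M-*ʳ : ∀ {x} r → M x → M (x * r)
    M-*ʳ r x∈M = M-resp (*-comm r _) (proj₂ (proj₂ (proj₂ (proj₁ M-maximal))) r x∈M)

    1∉M : ¬ M 1#
    1∉M = proj₁ (proj₂ M-maximal)

  em : ExcludedMiddle 0ℓ
  em = IsMaximalIdeal⇒ExcludedMiddle M-maximal

  Jacobson⇒M : ∀ {x} → Jacobson S x → M x
  Jacobson⇒M x∈J = x∈J M M-maximal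

  M⇒Jacobson : ∀ {x} → M x → Jacobson S x
  M⇒Jacobson {x} x∈M N N-maximal = proj₂ (proj₂ (proj₂ local) N N-maximal x) x∈M

  IsUnit⇒∉M : ∀ {x} → IsUnit x → ¬ M x
  IsUnit⇒∉M (u , xu≈1) x∈M = 1∉M (M-resp xu≈1 (M-*ʳ u x∈M))

  Unimodular⇒∉M : ∀ {c d} → Unimodular (c , d) → M c → M d → ⊥
  Unimodular⇒∉M (s , t , cs+dt≈1) c∈M d∈M = 1∉M (M-resp cs+dt≈1 (M-+ (M-*ʳ s c∈M) (M-*ʳ t d∈M)))

  Distant⇒det∉M : ∀ p q → Distant S p q → ¬ M (det p q)
  Distant⇒det∉M p q p#q = IsUnit⇒∉M (Distant⇒IsUnit-det p q p#q)

  -- Plücker: det x y (p · w) − det p y (x · w) = det x p (y · w), with w = (s , t) and y · w = 1.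
  det∈M-trans : ∀ x p y → Unimodular y → M (det x y) → M (det p y) → M (det x p)
  det∈M-trans (a , b) (a′ , b′) (c , d) (s , t , cs+dt≈1) xy∈M py∈M = M-resp plücker
    (M-+ (M-*ʳ (a′ * s + b′ * t) xy∈M) (M-*ʳ (- (a * s + b * t)) py∈M))
    where
    plücker : (a * d - b * c) * (a′ * s + b′ * t) + (a′ * d - b′ * c) * (- (a * s + b * t)) ≈ a * b′ - b * a′
    plücker = trans (solve 8 (λ a b a′ b′ c d s t →
        (a :* d :- b :* c) :* (a′ :* s :+ b′ :* t) :+ (a′ :* d :- b′ :* c) :* (:- (a :* s :+ b :* t))
          := (a :* b′ :- b :* a′) :* (c :* s :+ d :* t)) refl a b a′ b′ c d s t)
      (trans (*-congˡ cs+dt≈1) (*-identityʳ _))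

  module Finite {N} (finite : CardOf Carrier _≈_ (Total S) N) where

    ∉M⇒IsUnit : ∀ {x} → ¬ M x → IsUnit x
    ∉M⇒IsUnit {x} x∉M with em {IsUnit x}
    ... | yes unit = unit
    ... | no ¬unit with N′ , N′-maximal , x∈N′ ← ¬IsUnit⇒InMaximal em finite ¬unit =
      ⊥-elim (x∉M (proj₁ (proj₂ (proj₂ local) N′ N′-maximal x) x∈N′))

    ¬IsUnit⇒M : ∀ {x} → ¬ IsUnit x → M x
    ¬IsUnit⇒M ¬unit = decidable-stable em λ x∉M → ¬unit (∉M⇒IsUnit x∉M)

    ¬Distant⇒det∈M : ∀ p q → ¬ Distant S p q → M (det p q)
    ¬Distant⇒det∈M p q ¬p#q = ¬IsUnit⇒M λ unit → ¬p#q (IsUnit-det⇒Distant p q unit)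

    -- In a local ring, being non-distant is an equivalence relation.
    Distant-of-neighbour : ∀ {x p y} → Admissible S y → Distant S x p → ¬ Distant S x y → Distant S p y
    Distant-of-neighbour {x} {p} {y} y-admissible x#p ¬x#y = decidable-stable em λ ¬p#y →
      Distant⇒det∉M x p x#p (det∈M-trans x p y (Admissible⇒Unimodular y y-admissible)
        (¬Distant⇒det∈M x y ¬x#y) (¬Distant⇒det∈M p y ¬p#y))

    module _ {j} (J-card : CardOf Carrier _≈_ (Jacobson S) j) where

      M-card : CardOf Carrier _≈_ M j
      M-card = CardOf-cong isEquivalence (λ _ → Jacobson⇒M) (λ _ → M⇒Jacobson) J-card

      private
        admissible-line : ∀ p v → det p v ≈ 1# → ∀ t → Admissible S (line p v t)
        admissible-line p v det≈1 t = Unimodular⇒Admissible _ (Unimodular-line p v det≈1 t)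

      unit-first-card : CardOf (Pair S) (SameSub S) (λ y → Admissible S y × ¬ M (proj₁ y)) N
      unit-first-card = CardOf-line (1# , 0#) (0# , 1#) det≈1
        (λ b _ → admissible-line (1# , 0#) (0# , 1#) det≈1 b , unit-first b) surjective finite
        where
        open import Relation.Binary.Reasoning.Setoid setoid
        det≈1 : det (1# , 0#) (0# , 1#) ≈ 1#
        det≈1 = solve 0 (con (+ 1) :* con (+ 1) :- con (+ 0) :* con (+ 0) := con (+ 1)) refl
        unit-first : ∀ b → ¬ M (1# + b * 0#)
        unit-first b 1+b0∈M = 1∉M (M-resp (solve 1 (λ b → con (+ 1) :+ b :* con (+ 0) := con (+ 1)) refl b) 1+b0∈M)
        surjective : ∀ y → Admissible S y × ¬ M (proj₁ y) → ∃ λ b → Total S b × SameSub S y (line (1# , 0#) (0# , 1#) b)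
        surjective (c , d) (y-admissible , c∉M) with u , cu≈1 ← ∉M⇒IsUnit c∉M =
          d * u , _ , det≈0⇒SameSub _ _ (Admissible⇒Unimodular _ y-admissible) (Unimodular-line _ _ det≈1 _) (begin
            c * (0# + d * u * 1#) - d * (1# + d * u * 0#)
              ≈⟨ solve 3 (λ c d u → c :* (con (+ 0) :+ d :* u :* con (+ 1)) :- d :* (con (+ 1) :+ d :* u :* con (+ 0))
                                     := d :* (c :* u :- con (+ 1))) refl c d u ⟩
            d * (c * u - 1#) ≈⟨ *-congˡ (trans (+-congʳ cu≈1) (-‿inverseʳ 1#)) ⟩
            d * 0#           ≈⟨ zeroʳ d ⟩
            0#               ∎)

      M-first-card : CardOf (Pair S) (SameSub S) (λ y → Admissible S y × M (proj₁ y)) j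
      M-first-card = CardOf-line (0# , - 1#) (1# , 0#) det≈1
        (λ m m∈M → admissible-line (0# , - 1#) (1# , 0#) det≈1 m , M-first m∈M) surjective M-card
        where
        open import Relation.Binary.Reasoning.Setoid setoid
        det≈1 : det (0# , - 1#) (1# , 0#) ≈ 1#
        det≈1 = solve 0 (con (+ 0) :* con (+ 0) :- (:- con (+ 1)) :* con (+ 1) := con (+ 1)) refl
        M-first : ∀ {m} → M m → M (0# + m * 1#)
        M-first {m} = M-resp (solve 1 (λ m → m := con (+ 0) :+ m :* con (+ 1)) refl m)
        surjective : ∀ y → Admissible S y × M (proj₁ y) → ∃ λ m → M m × SameSub S y (line (0# , - 1#) (1# , 0#) m)
        surjective (c , d) (y-admissible , c∈M) with em {M d}
        ... | yes d∈M = ⊥-elim (Unimodular⇒∉M (Admissible⇒Unimodular _ y-admissible) c∈M d∈M)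
        ... | no  d∉M with u , du≈1 ← ∉M⇒IsUnit d∉M =
          - (c * u) , M-resp (solve 2 (λ c u → c :* (:- u) := :- (c :* u)) refl c u) (M-*ʳ (- u) c∈M) ,
          det≈0⇒SameSub _ _ (Admissible⇒Unimodular _ y-admissible) (Unimodular-line _ _ det≈1 _) (begin
            c * (- 1# + - (c * u) * 0#) - d * (0# + - (c * u) * 1#)
              ≈⟨ solve 3 (λ c d u → c :* (:- con (+ 1) :+ (:- (c :* u)) :* con (+ 0)) :- d :* (con (+ 0) :+ (:- (c :* u)) :* con (+ 1))
                                     := c :* (d :* u :- con (+ 1))) refl c d u ⟩
            c * (d * u - 1#) ≈⟨ *-congˡ (trans (+-congʳ du≈1) (-‿inverseʳ 1#)) ⟩
            c * 0#           ≈⟨ zeroʳ c ⟩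
            0#               ∎)

      -- Every point is R(1 , b) or R(m , −1) with m ∈ M, and not both.
      Admissible-card : CardOf (Pair S) (SameSub S) (Admissible S) (N ℕ.+ j)
      Admissible-card = CardOf-cong SameSub-isEquivalence
        (λ { y (inj₁ (y-admissible , _)) → y-admissible ; y (inj₂ (y-admissible , _)) → y-admissible })
        (λ y y-admissible → Sum.map (y-admissible ,_) (y-admissible ,_) (first-coordinate y))
        (CardOf-⊎ SameSub-isEquivalence disjoint unit-first-card M-first-card)
        where
        first-coordinate : ∀ y → ¬ M (proj₁ y) ⊎ M (proj₁ y)
        first-coordinate y with em {M (proj₁ y)}
        ... | yes c∈M = inj₂ c∈M
        ... | no  c∉M = inj₁ c∉M
        disjoint : ∀ y z → Admissible S y × ¬ M (proj₁ y) → Admissible S z × M (proj₁ z) → ¬ SameSub S y z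
        disjoint y z (_ , c∉M) (_ , c′∈M) y≡z with r , c≈rc′ , _ ← proj₁ (y≡z y) (InSub-refl y) =
          c∉M (M-resp (trans (*-comm _ r) (sym c≈rc′)) (M-*ʳ r c′∈M))

      neighbour-on-line : ∀ {a b s t} → a * s + b * t ≈ 1# → ∀ y → Admissible S y × ¬ Distant S (a , b) y →
        ∃ λ m → M m × SameSub S y (line (a , b) (- t , s) m)
      neighbour-on-line {a} {b} {s} {t} as+bt≈1 y@(c , d) (y-admissible , ¬x#y) with em {M (c * s + d * t)}
      ... | yes α∈M = ⊥-elim (Unimodular⇒∉M (Admissible⇒Unimodular y y-admissible) c∈M d∈M)
        where
        β∈M : M (a * d - b * c)
        β∈M = ¬Distant⇒det∈M (a , b) y ¬x#y
        c∈M : M c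
        c∈M = M-resp (trans (solve 6 (λ a b c d s t → (c :* s :+ d :* t) :* a :+ (a :* d :- b :* c) :* (:- t)
                                                    := c :* (a :* s :+ b :* t)) refl a b c d s t)
                            (trans (*-congˡ as+bt≈1) (*-identityʳ c)))
                     (M-+ (M-*ʳ a α∈M) (M-*ʳ (- t) β∈M))
        d∈M : M d
        d∈M = M-resp (trans (solve 6 (λ a b c d s t → (c :* s :+ d :* t) :* b :+ (a :* d :- b :* c) :* s
                                                    := d :* (a :* s :+ b :* t)) refl a b c d s t)
                            (trans (*-congˡ as+bt≈1) (*-identityʳ d)))
                     (M-+ (M-*ʳ b α∈M) (M-*ʳ s β∈M))
      ... | no α∉M with u , αu≈1 ← ∉M⇒IsUnit α∉M =
        (a * d - b * c) * u , M-*ʳ u (¬Distant⇒det∈M (a , b) y ¬x#y) ,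
        det≈0⇒SameSub _ _ (Admissible⇒Unimodular y y-admissible)
          (Unimodular-line (a , b) (- t , s) (det-complement as+bt≈1) _) (begin
          c * (b + (a * d - b * c) * u * s) - d * (a + (a * d - b * c) * u * - t)
            ≈⟨ solve 7 (λ a b c d s t u →
                 c :* (b :+ (a :* d :- b :* c) :* u :* s) :- d :* (a :+ (a :* d :- b :* c) :* u :* (:- t))
                   := (a :* d :- b :* c) :* ((c :* s :+ d :* t) :* u :- con (+ 1))) refl a b c d s t u ⟩
          (a * d - b * c) * ((c * s + d * t) * u - 1#) ≈⟨ *-congˡ (trans (+-congʳ αu≈1) (-‿inverseʳ 1#)) ⟩
          (a * d - b * c) * 0#                         ≈⟨ zeroʳ _ ⟩
          0#                                           ∎)
        where open import Relation.Binary.Reasoning.Setoid setoid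

      neighbourhood-card : ∀ x → Admissible S x → CardOf (Pair S) (SameSub S) (λ y → Admissible S y × ¬ Distant S x y) j
      neighbourhood-card x@(a , b) x-admissible with s , t , as+bt≈1 ← Admissible⇒Unimodular x x-admissible =
        CardOf-line x (- t , s) det≈1 neighbour (neighbour-on-line as+bt≈1) M-card
        where
        det≈1 : det x (- t , s) ≈ 1#
        det≈1 = det-complement as+bt≈1
        neighbour : ∀ m → M m → Admissible S (line x (- t , s) m) × ¬ Distant S x (line x (- t , s) m)
        neighbour m m∈M = Unimodular⇒Admissible _ (Unimodular-line x (- t , s) det≈1 m) ,
          λ x#y → Distant⇒det∉M x _ x#y
            (M-resp (sym (trans (det-base-line x (- t , s) m) (trans (*-congˡ det≈1) (*-identityʳ m)))) m∈M)

      -- The points distant from ps but not from x are exactly the j neighbours of x.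
      DistantToAll-step : ∀ x ps → Admissible S x → All (Distant S x) ps → ∀ {c} →
        CardOf (Pair S) (SameSub S) (DistantToAll ps) c →
        ∃ λ k → CardOf (Pair S) (SameSub S) (DistantToAll (x ∷ ps)) k × k ℕ.+ j ≡ c
      DistantToAll-step x ps x-admissible x#ps {c} c-card =
        split (CardOf-partition SameSub-isEquivalence {P = DistantToAll ps} {D = Distant S x}
                 (λ _ → em) (λ _ _ _ _ → Distant-respʳ-SameSub x) c-card)
        where
        split : (∃ λ k → ∃ λ k′ → CardOf (Pair S) (SameSub S) (λ y → DistantToAll ps y × Distant S x y) k ×
                  CardOf (Pair S) (SameSub S) (λ y → DistantToAll ps y × ¬ Distant S x y) k′ × k ℕ.+ k′ ≡ c) →
                ∃ λ k → CardOf (Pair S) (SameSub S) (DistantToAll (x ∷ ps)) k × k ℕ.+ j ≡ c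
        split (k , k′ , k-card , k′-card , k+k′≡c) =
          k , CardOf-cong SameSub-isEquivalence (λ _ ((y-admissible , ps#y) , x#y) → y-admissible , x#y ∷ ps#y)
                (λ { _ (y-admissible , x#y ∷ ps#y) → (y-admissible , ps#y) , x#y }) k-card ,
          ≡.trans (≡.cong (k ℕ.+_) (≡.sym k′≡j)) k+k′≡c
          where
          k′≡j : k′ ≡ j
          k′≡j = CardOf-unique SameSub-isEquivalence
            (CardOf-cong SameSub-isEquivalence (λ _ ((y-admissible , _) , ¬x#y) → y-admissible , ¬x#y)
              (λ _ (y-admissible , ¬x#y) →
                (y-admissible , All.map (λ x#p → Distant-of-neighbour y-admissible x#p ¬x#y) x#ps) , ¬x#y)
              k′-card)
            (neighbourhood-card x x-admissible)

      DistantToAll-card : ∀ ps → All (Admissible S) ps → AllPairs (Distant S) ps →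
        ∃ λ c → CardOf (Pair S) (SameSub S) (DistantToAll ps) c × c ℕ.+ length ps ℕ.* j ≡ N ℕ.+ j
      DistantToAll-card [] _ _ =
        N ℕ.+ j , CardOf-cong SameSub-isEquivalence (λ _ y-admissible → y-admissible , []) (λ _ → proj₁) Admissible-card ,
        ℕ.+-identityʳ _
      DistantToAll-card (x ∷ ps) (x-admissible ∷ ps-admissible) (x#ps ∷ ps-distant) =
        add (DistantToAll-card ps ps-admissible ps-distant)
        where
        add : (∃ λ c → CardOf (Pair S) (SameSub S) (DistantToAll ps) c × c ℕ.+ length ps ℕ.* j ≡ N ℕ.+ j) →
              ∃ λ c → CardOf (Pair S) (SameSub S) (DistantToAll (x ∷ ps)) c × c ℕ.+ (j ℕ.+ length ps ℕ.* j) ≡ N ℕ.+ j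
        add (c , c-card , c-eq) = let k , k-card , k+j≡c = DistantToAll-step x ps x-admissible x#ps c-card in
          k , k-card , ≡.trans (≡.sym (ℕ.+-assoc k j _)) (≡.trans (≡.cong (ℕ._+ length ps ℕ.* j) k+j≡c) c-eq)

module ProductRing (R : CommutativeRing 0ℓ 0ℓ) {m : ℕ} (Rs : Fin m → CommutativeRing 0ℓ 0ℓ)
  (φ : CommutativeRing.Carrier R → (i : Fin m) → CommutativeRing.Carrier (Rs i)) (iso : IsProductIso R Rs φ) where

  open CommutativeRing R
  module Rs (i : Fin m) = CommutativeRing (Rs i)
  module ℙ = ProjectiveLine R
  module ℙs (i : Fin m) = ProjectiveLine (Rs i)

  φ-cong : ∀ {x y} → x ≈ y → ∀ i → Rs._≈_ i (φ x i) (φ y i)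
  φ-cong = proj₁ iso

  φ-+ : ∀ x y i → Rs._≈_ i (φ (x + y) i) (Rs._+_ i (φ x i) (φ y i))
  φ-+ = proj₁ (proj₂ iso)

  φ-* : ∀ x y i → Rs._≈_ i (φ (x * y) i) (Rs._*_ i (φ x i) (φ y i))
  φ-* = proj₁ (proj₂ (proj₂ iso))

  φ-1 : ∀ i → Rs._≈_ i (φ 1# i) (Rs.1# i)
  φ-1 = proj₁ (proj₂ (proj₂ (proj₂ iso)))

  φ-injective : ∀ x y → (∀ i → Rs._≈_ i (φ x i) (φ y i)) → x ≈ y
  φ-injective = proj₁ (proj₂ (proj₂ (proj₂ (proj₂ iso))))

  glue : ((i : Fin m) → Rs.Carrier i) → Carrier
  glue f = proj₁ (proj₂ (proj₂ (proj₂ (proj₂ (proj₂ iso)))) f)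

  φ-glue : ∀ f i → Rs._≈_ i (φ (glue f) i) (f i)
  φ-glue f = proj₂ (proj₂ (proj₂ (proj₂ (proj₂ (proj₂ iso)))) f)

  φ-0 : ∀ i → Rs._≈_ i (φ 0# i) (Rs.0# i)
  φ-0 i = x+x≈x⇒x≈0 _ (Rs.trans i (Rs.sym i (φ-+ 0# 0# i)) (φ-cong (+-identityˡ 0#) i))
    where open import Algebra.Properties.Ring (Rs.ring i) using (x+x≈x⇒x≈0)

  φ-neg : ∀ x i → Rs._≈_ i (φ (- x) i) (Rs.-_ i (φ x i))
  φ-neg x i = +-inverseʳ-unique (φ x i) (φ (- x) i)
    (Rs.trans i (Rs.sym i (φ-+ x (- x) i)) (Rs.trans i (φ-cong (-‿inverseʳ x) i) (φ-0 i)))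
    where open import Algebra.Properties.Ring (Rs.ring i) using (+-inverseʳ-unique)

  Φ : Pair R → (i : Fin m) → Pair (Rs i)
  Φ (a , b) i = φ a i , φ b i

  Ψ : ((i : Fin m) → Pair (Rs i)) → Pair R
  Ψ t = glue (λ i → proj₁ (t i)) , glue (λ i → proj₂ (t i))

  φ-det : ∀ v w i → Rs._≈_ i (φ (ℙ.det v w) i) (ℙs.det i (Φ v i) (Φ w i))
  φ-det (a , b) (c , d) i = Rs.trans i (φ-+ (a * d) (- (b * c)) i)
    (Rs.+-cong i (φ-* a d i) (Rs.trans i (φ-neg (b * c) i) (Rs.-‿cong i (φ-* b c i))))

  det-Ψ : ∀ t t′ i → Rs._≈_ i (ℙs.det i (Φ (Ψ t) i) (Φ (Ψ t′) i)) (ℙs.det i (t i) (t′ i))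
  det-Ψ t t′ i = ℙs.det-cong i (φ-glue _ i) (φ-glue _ i) (φ-glue _ i) (φ-glue _ i)

  IsUnit-proj : ∀ {x} → ℙ.IsUnit x → ∀ i → ℙs.IsUnit i (φ x i)
  IsUnit-proj {x} (u , xu≈1) i = φ u i , Rs.trans i (Rs.sym i (φ-* x u i)) (Rs.trans i (φ-cong xu≈1 i) (φ-1 i))

  IsUnit-glue : ∀ {x} → (∀ i → ℙs.IsUnit i (φ x i)) → ℙ.IsUnit x
  IsUnit-glue {x} units = glue (λ i → proj₁ (units i)) , φ-injective _ _ λ i →
    Rs.trans i (φ-* x _ i) (Rs.trans i (Rs.*-congˡ i (φ-glue _ i)) (Rs.trans i (proj₂ (units i)) (Rs.sym i (φ-1 i))))

  Unimodular-proj : ∀ v → ℙ.Unimodular v → ∀ i → ℙs.Unimodular i (Φ v i)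
  Unimodular-proj (a , b) (s , t , as+bt≈1) i = φ s i , φ t i ,
    Rs.trans i (Rs.sym i (Rs.+-cong i (φ-* a s i) (φ-* b t i)))
      (Rs.trans i (Rs.sym i (φ-+ _ _ i)) (Rs.trans i (φ-cong as+bt≈1 i) (φ-1 i)))

  Unimodular-glue : ∀ v → (∀ i → ℙs.Unimodular i (Φ v i)) → ℙ.Unimodular v
  Unimodular-glue (a , b) unimodular = glue (λ i → proj₁ (unimodular i)) , glue (λ i → proj₁ (proj₂ (unimodular i))) ,
    φ-injective _ _ λ i → Rs.trans i (φ-+ _ _ i) (Rs.trans i (Rs.+-cong i (φ-* a _ i) (φ-* b _ i))
      (Rs.trans i (Rs.+-cong i (Rs.*-congˡ i (φ-glue _ i)) (Rs.*-congˡ i (φ-glue _ i)))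
        (Rs.trans i (proj₂ (proj₂ (unimodular i))) (Rs.sym i (φ-1 i)))))

  Admissible-proj : ∀ v → Admissible R v → ∀ i → Admissible (Rs i) (Φ v i)
  Admissible-proj v v-admissible i =
    ℙs.Unimodular⇒Admissible i _ (Unimodular-proj v (ℙ.Admissible⇒Unimodular v v-admissible) i)

  Admissible-glue : ∀ v → (∀ i → Admissible (Rs i) (Φ v i)) → Admissible R v
  Admissible-glue v admissible =
    ℙ.Unimodular⇒Admissible v (Unimodular-glue v (λ i → ℙs.Admissible⇒Unimodular i _ (admissible i)))

  Distant-proj : ∀ v w → Distant R v w → ∀ i → Distant (Rs i) (Φ v i) (Φ w i)
  Distant-proj v w v#w i = ℙs.IsUnit-det⇒Distant i _ _
    (ℙs.IsUnit-resp i (φ-det v w i) (IsUnit-proj (ℙ.Distant⇒IsUnit-det v w v#w) i))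

  Distant-glue : ∀ v w → (∀ i → Distant (Rs i) (Φ v i) (Φ w i)) → Distant R v w
  Distant-glue v w distant = ℙ.IsUnit-det⇒Distant v w
    (IsUnit-glue λ i → ℙs.IsUnit-resp i (Rs.sym i (φ-det v w i)) (ℙs.Distant⇒IsUnit-det i _ _ (distant i)))

  det≈0-proj : ∀ v w → ℙ.det v w ≈ 0# → ∀ i → Rs._≈_ i (ℙs.det i (Φ v i) (Φ w i)) (Rs.0# i)
  det≈0-proj v w det≈0 i = Rs.trans i (Rs.sym i (φ-det v w i)) (Rs.trans i (φ-cong det≈0 i) (φ-0 i))

  det≈0-glue : ∀ v w → (∀ i → Rs._≈_ i (ℙs.det i (Φ v i) (Φ w i)) (Rs.0# i)) → ℙ.det v w ≈ 0#
  det≈0-glue v w det≈0 = φ-injective _ _ λ i → Rs.trans i (φ-det v w i) (Rs.trans i (det≈0 i) (Rs.sym i (φ-0 i)))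

  All-∀ : ∀ {A : Set} {Q : Fin m → A → Set} {xs : List A} → (∀ i → All (Q i) xs) → All (λ x → ∀ i → Q i x) xs
  All-∀ {xs = []}     all = []
  All-∀ {xs = x ∷ xs} all = (λ i → All.head (all i)) ∷ All-∀ (λ i → All.tail (all i))

  DistantToAll-proj : ∀ ps v → ℙ.DistantToAll ps v → ∀ i → ℙs.DistantToAll i (map (λ p → Φ p i) ps) (Φ v i)
  DistantToAll-proj ps v (v-admissible , ps#v) i =
    Admissible-proj v v-admissible i , All.map⁺ (All.map (λ {p} p#v → Distant-proj p v p#v i) ps#v)

  DistantToAll-glue : ∀ ps t → (∀ i → ℙs.DistantToAll i (map (λ p → Φ p i) ps) (t i)) → ℙ.DistantToAll ps (Ψ t)
  DistantToAll-glue ps t distant =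
    Admissible-glue (Ψ t) (λ i → ℙs.Unimodular⇒Admissible i _ (ℙs.Unimodular-resp i (Rs.sym i (φ-glue _ i))
      (Rs.sym i (φ-glue _ i)) (ℙs.Admissible⇒Unimodular i _ (proj₁ (distant i))))) ,
    All.map (λ {p} p#t → Distant-glue p (Ψ t) λ i → ℙs.Distant-respʳ-SameSub i (Φ p i)
               (ℙs.≈⇒SameSub i (Rs.sym i (φ-glue _ i)) (Rs.sym i (φ-glue _ i))) (p#t i))
      (All-∀ λ i → All.map⁻ (proj₂ (distant i)))

  DistantToAll-card : ∀ ps {cs : Fin m → ℕ} →
    (∀ i → CardOf (Pair (Rs i)) (SameSub (Rs i)) (ℙs.DistantToAll i (map (λ p → Φ p i) ps)) (cs i)) →
    CardOf (Pair R) (SameSub R) (ℙ.DistantToAll ps) (∏ℕ cs)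
  DistantToAll-card ps cards = CardOf-transport {_≈_ = SameSub R} ℙ.SameSub-trans Ψ (DistantToAll-glue ps)
    (λ t t′ t-distant t′-distant t≡t′ → ℙ.det≈0⇒SameSub _ _ (unimodular t t-distant) (unimodular t′ t′-distant)
      (det≈0-glue _ _ λ i → Rs.trans i (det-Ψ t t′ i) (ℙs.SameSub⇒det≈0 i _ _ (t≡t′ i))))
    (λ t t′ t-distant t′-distant Ψt≡Ψt′ i → ℙs.det≈0⇒SameSub i _ _
      (ℙs.Admissible⇒Unimodular i _ (proj₁ (t-distant i))) (ℙs.Admissible⇒Unimodular i _ (proj₁ (t′-distant i)))
      (Rs.trans i (Rs.sym i (det-Ψ t t′ i)) (det≈0-proj _ _ (ℙ.SameSub⇒det≈0 _ _ Ψt≡Ψt′) i)))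
    (λ v v-distant → Φ v , DistantToAll-proj ps v v-distant ,
      ℙ.det≈0⇒SameSub _ _ (ℙ.Admissible⇒Unimodular v (proj₁ v-distant))
        (unimodular (Φ v) (DistantToAll-proj ps v v-distant))
        (det≈0-glue _ _ λ i → Rs.trans i (ℙs.det-congʳ i (Φ v i) (φ-glue _ i) (φ-glue _ i)) (ℙs.det-self i (Φ v i))))
    (CardOf-Π m {_~_ = λ i → SameSub (Rs i)} cards)
    where
    unimodular : ∀ t → (∀ i → ℙs.DistantToAll i (map (λ p → Φ p i) ps) (t i)) → ℙ.Unimodular (Ψ t)
    unimodular t distant = ℙ.Admissible⇒Unimodular _ (proj₁ (DistantToAll-glue ps t distant))

  φ-1-* : ∀ r x i → Rs._≈_ i (φ (1# - r * x) i) (Rs._-_ i (Rs.1# i) (Rs._*_ i (φ r i) (φ x i)))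
  φ-1-* r x i = Rs.trans i (φ-+ 1# (- (r * x)) i)
    (Rs.+-cong i (φ-1 i) (Rs.trans i (φ-neg (r * x) i) (Rs.-‿cong i (φ-* r x i))))

  single : (i : Fin m) → Rs.Carrier i → (k : Fin m) → Rs.Carrier k
  single i a k with i Fin.≟ k
  ... | yes ≡.refl = a
  ... | no  _      = Rs.0# k

  single-at : ∀ i a → Rs._≈_ i (single i a i) a
  single-at i a with i Fin.≟ i
  ... | yes ≡.refl = Rs.refl i
  ... | no  i≢i    = ⊥-elim (i≢i ≡.refl)

  module _ (em : ExcludedMiddle 0ℓ) {N} (R-finite : CardOf Carrier _≈_ (Total R) N)
    {Ns : Fin m → ℕ} (Rs-finite : ∀ i → CardOf (Rs.Carrier i) (Rs._≈_ i) (Total (Rs i)) (Ns i)) where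
    module I = Ideals R
    module Is (i : Fin m) = Ideals (Rs i)

    Jacobson-proj : ∀ {x} → Jacobson R x → ∀ i → Jacobson (Rs i) (φ x i)
    Jacobson-proj {x} x∈J i = Is.IsUnit⇒Jacobson i em λ rᵢ →
      ℙs.IsUnit-resp i (Rs.trans i (φ-1-* (glue (single i rᵢ)) x i) (Rs.+-congˡ i (Rs.-‿cong i (Rs.*-congʳ i
          (Rs.trans i (φ-glue _ i) (single-at i rᵢ))))))
        (IsUnit-proj (I.Jacobson⇒IsUnit em R-finite x∈J (glue (single i rᵢ))) i)

    Jacobson-glue : ∀ {x} → (∀ i → Jacobson (Rs i) (φ x i)) → Jacobson R x
    Jacobson-glue {x} x∈J = I.IsUnit⇒Jacobson em λ r → IsUnit-glue λ i →
      ℙs.IsUnit-resp i (Rs.sym i (φ-1-* r x i)) (Is.Jacobson⇒IsUnit i em (Rs-finite i) (x∈J i) (φ r i))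

    Jacobson-card : ∀ {js : Fin m → ℕ} → (∀ i → CardOf (Rs.Carrier i) (Rs._≈_ i) (Jacobson (Rs i)) (js i)) →
      CardOf Carrier _≈_ (Jacobson R) (∏ℕ js)
    Jacobson-card J-cards = CardOf-transport trans glue
      (λ t t∈J → Jacobson-glue λ i → Is.Jacobson-resp i (Rs.sym i (φ-glue t i)) (t∈J i))
      (λ t t′ _ _ t≈t′ → φ-injective _ _ λ i → Rs.trans i (φ-glue t i) (Rs.trans i (t≈t′ i) (Rs.sym i (φ-glue t′ i))))
      (λ t t′ _ _ t≈t′ i → Rs.trans i (Rs.sym i (φ-glue t i)) (Rs.trans i (φ-cong t≈t′ i) (φ-glue t′ i)))
      (λ x x∈J → (λ i → φ x i) , Jacobson-proj x∈J , φ-injective _ _ λ i → Rs.sym i (φ-glue _ i))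
      (CardOf-Π m {_~_ = Rs._≈_} J-cards)

  module _ (locals : ∀ i → IsLocal (Rs i)) {Ns js : Fin m → ℕ}
    (Rs-finite : ∀ i → CardOf (Rs.Carrier i) (Rs._≈_ i) (Total (Rs i)) (Ns i))
    (J-cards : ∀ i → CardOf (Rs.Carrier i) (Rs._≈_ i) (Jacobson (Rs i)) (js i)) where

    DistantToAll-count : ∀ ps → All (Admissible R) ps → AllPairs (Distant R) ps →
      ∃ λ (cs : Fin m → ℕ) → CardOf (Pair R) (SameSub R) (ℙ.DistantToAll ps) (∏ℕ cs) ×
                              ∀ i → cs i ℕ.+ length ps ℕ.* js i ≡ Ns i ℕ.+ js i
    DistantToAll-count ps ps-admissible ps-distant =
      (λ i → proj₁ (local i)) , DistantToAll-card ps (λ i → proj₁ (proj₂ (local i))) ,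
      λ i → ≡.subst (λ l → proj₁ (local i) ℕ.+ l ℕ.* js i ≡ Ns i ℕ.+ js i) (List.length-map (λ p → Φ p i) ps)
                    (proj₂ (proj₂ (local i)))
      where
      local : ∀ i → ∃ λ c → CardOf (Pair (Rs i)) (SameSub (Rs i)) (ℙs.DistantToAll i (map (λ p → Φ p i) ps)) c ×
                            c ℕ.+ length (map (λ p → Φ p i) ps) ℕ.* js i ≡ Ns i ℕ.+ js i
      local i = LocalRing.Finite.DistantToAll-card (Rs i) (locals i) (Rs-finite i) (J-cards i) (map (λ p → Φ p i) ps)
        (All.map⁺ (All.map (λ {p} p-admissible → Admissible-proj p p-admissible i) ps-admissible))
        (AllPairs.map⁺ (AllPairs.map (λ {p} {p′} p#p′ → Distant-proj p p′ p#p′ i) ps-distant))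

module InclusionExclusion (R : CommutativeRing 0ℓ 0ℓ) (em : ExcludedMiddle 0ℓ)
  (F : ℕ → ℕ → ℤ) (F-pascal : ∀ l k → F (suc l) k ≡ F l k ℤ.- F l (suc k)) where
  open ProjectiveLine R

  DistantToAllNone : List (Pair R) → List (Pair R) → Pair R → Set
  DistantToAllNone ps qs y = DistantToAll ps y × All (λ q → ¬ Distant R q y) qs

  Count : List (Pair R) → List (Pair R) → Set
  Count ps qs = ∃ λ n → CardOf (Pair R) (SameSub R) (DistantToAllNone ps qs) n × + n ≡ F (length qs) (length ps)

  -- Points distant to ps and to none of x ∷ qs = those distant to none of qs minus those also distant to x.
  Count-step : ∀ x ps qs → Count ps qs → Count (x ∷ ps) qs → Count ps (x ∷ qs)
  Count-step x ps qs (N , N-card , N≡F) (N′ , N′-card , N′≡F) =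
    split (CardOf-partition SameSub-isEquivalence {P = DistantToAllNone ps qs} {D = Distant R x}
             (λ _ → em) (λ _ _ _ _ → Distant-respʳ-SameSub x) N-card)
    where
    open ≡.≡-Reasoning
    cancel : ∀ a b → b ≡ (a ℤ.+ b) ℤ.- a
    cancel = solve-∀
    split : (∃ λ k → ∃ λ k′ → CardOf (Pair R) (SameSub R) (λ y → DistantToAllNone ps qs y × Distant R x y) k ×
              CardOf (Pair R) (SameSub R) (λ y → DistantToAllNone ps qs y × ¬ Distant R x y) k′ × k ℕ.+ k′ ≡ N) →
            Count ps (x ∷ qs)
    split (k , k′ , k-card , k′-card , k+k′≡N) =
      k′ ,
      CardOf-cong SameSub-isEquivalence (λ _ ((y-distant , ¬qs#y) , ¬x#y) → y-distant , ¬x#y ∷ ¬qs#y)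
        (λ { _ (y-distant , ¬x#y ∷ ¬qs#y) → (y-distant , ¬qs#y) , ¬x#y }) k′-card ,
      (begin
        + k′                                  ≡⟨ cancel (+ k) (+ k′) ⟩
        (+ k ℤ.+ + k′) ℤ.- + k                ≡⟨ ≡.cong₂ ℤ._-_ (≡.cong +_ k+k′≡N) (≡.cong +_ k≡N′) ⟩
        + N ℤ.- + N′                          ≡⟨ ≡.cong₂ ℤ._-_ N≡F N′≡F ⟩
        F (length qs) (length ps) ℤ.- F (length qs) (suc (length ps)) ≡⟨ F-pascal (length qs) (length ps) ⟨
        F (suc (length qs)) (length ps)       ∎)
      where
      k≡N′ : k ≡ N′
      k≡N′ = CardOf-unique SameSub-isEquivalence
        (CardOf-cong SameSub-isEquivalence (λ _ (((y-admissible , ps#y) , ¬qs#y) , x#y) → (y-admissible , x#y ∷ ps#y) , ¬qs#y)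
          (λ { _ ((y-admissible , x#y ∷ ps#y) , ¬qs#y) → ((y-admissible , ps#y) , ¬qs#y) , x#y }) k-card)
        N′-card

  module _ (base : ∀ ps → All (Admissible R) ps → AllPairs (Distant R) ps →
                   ∃ λ n → CardOf (Pair R) (SameSub R) (DistantToAll ps) n × + n ≡ F 0 (length ps)) where

    count : ∀ qs ps → All (Admissible R) ps → All (Admissible R) qs → AllPairs (Distant R) ps → AllPairs (Distant R) qs →
      All (λ q → All (Distant R q) ps) qs → Count ps qs
    count [] ps ps-admissible _ ps-distant _ _ = let n , n-card , n≡F = base ps ps-admissible ps-distant in
      n , CardOf-cong SameSub-isEquivalence (λ _ distant → distant , []) (λ _ → proj₁) n-card , n≡F
    count (x ∷ qs) ps ps-admissible (x-admissible ∷ qs-admissible) ps-distant (x#qs ∷ qs-distant) (x#ps ∷ qs#ps) =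
      Count-step x ps qs
        (count qs ps ps-admissible qs-admissible ps-distant qs-distant qs#ps)
        (count qs (x ∷ ps) (x-admissible ∷ ps-admissible) qs-admissible (x#ps ∷ ps-distant) qs-distant
          (All.zipWith (λ (x#q , q#ps) → Distant-sym x#q ∷ q#ps) (x#qs , qs#ps)))

module IntegerSums where
  open import Data.Integer using (_+_; _*_; _-_; -_)
  open ≡ using (refl; cong; cong₂; sym; trans)
  open ≡.≡-Reasoning

  sum< : ℕ → (ℕ → ℤ) → ℤ
  sum< zero    f = + 0
  sum< (suc n) f = f 0 + sum< n (λ t → f (suc t))

  ∑-toℕ : ∀ n (f : ℕ → ℤ) → ∑ n (λ k → f (toℕ k)) ≡ sum< n f
  ∑-toℕ zero    f = refl
  ∑-toℕ (suc n) f = cong (λ x → f 0 + x) (∑-toℕ n (λ t → f (suc t)))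

  sum<-cong : ∀ n {f g : ℕ → ℤ} → (∀ t → f t ≡ g t) → sum< n f ≡ sum< n g
  sum<-cong zero    f≗g = refl
  sum<-cong (suc n) f≗g = cong₂ _+_ (f≗g 0) (sum<-cong n (λ t → f≗g (suc t)))

  sum<-+ : ∀ n (f g : ℕ → ℤ) → sum< n (λ t → f t + g t) ≡ sum< n f + sum< n g
  sum<-+ zero    f g = refl
  sum<-+ (suc n) f g = begin
    f 0 + g 0 + sum< n (λ t → f (suc t) + g (suc t))
      ≡⟨ cong (λ x → f 0 + g 0 + x) (sum<-+ n (λ t → f (suc t)) (λ t → g (suc t))) ⟩
    f 0 + g 0 + (sum< n (λ t → f (suc t)) + sum< n (λ t → g (suc t)))
      ≡⟨ interchange (f 0) (g 0) _ _ ⟩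
    f 0 + sum< n (λ t → f (suc t)) + (g 0 + sum< n (λ t → g (suc t))) ∎
    where
    interchange : ∀ a b c d → a + b + (c + d) ≡ a + c + (b + d)
    interchange = solve-∀

  sum<-neg : ∀ n (f : ℕ → ℤ) → sum< n (λ t → - f t) ≡ - sum< n f
  sum<-neg zero    f = refl
  sum<-neg (suc n) f = trans (cong (λ x → - f 0 + x) (sum<-neg n (λ t → f (suc t)))) (sym (ℤ.neg-distrib-+ (f 0) _))

  sum<-last : ∀ n (f : ℕ → ℤ) → sum< (suc n) f ≡ sum< n f + f n
  sum<-last zero    f = trans (ℤ.+-identityʳ (f 0)) (sym (ℤ.+-identityˡ (f 0)))
  sum<-last (suc n) f = trans (cong (λ x → f 0 + x) (sum<-last n (λ t → f (suc t)))) (sym (ℤ.+-assoc (f 0) _ _))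

  ∏ℕ-+ : ∀ {m} (f : Fin m → ℕ) → + ∏ℕ f ≡ ∏ m (λ i → + f i)
  ∏ℕ-+ {zero}  f = refl
  ∏ℕ-+ {suc m} f = trans (ℤ.pos-* (f zero) _) (cong (λ x → + f zero * x) (∏ℕ-+ (λ i → f (suc i))))

  ∏-cong : ∀ m {f g : Fin m → ℤ} → (∀ i → f i ≡ g i) → ∏ m f ≡ ∏ m g
  ∏-cong zero    f≗g = refl
  ∏-cong (suc m) f≗g = cong₂ _*_ (f≗g zero) (∏-cong m (λ i → f≗g (suc i)))

  ∏-* : ∀ m (f g : Fin m → ℤ) → ∏ m (λ i → f i * g i) ≡ ∏ m f * ∏ m g
  ∏-* zero    f g = refl
  ∏-* (suc m) f g = trans (cong (λ x → f zero * g zero * x) (∏-* m (λ i → f (suc i)) (λ i → g (suc i))))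
    (interchange (f zero) (g zero) _ _)
    where
    interchange : ∀ a b c d → a * b * (c * d) ≡ a * c * (b * d)
    interchange = solve-∀

  local-count : ∀ c k j q → c ℕ.+ k ℕ.* j ≡ q ℕ.* j ℕ.+ j → + c ≡ + j * (+ q + + 1 - + k)
  local-count c k j q eq = begin
    + c                               ≡⟨ cancel (+ c) (+ k) (+ j) ⟩
    (+ c + + k * + j) - + k * + j     ≡⟨ cong (_- + k * + j) (trans (ℤ.pos-+ c _) (cong (λ x → + c + x) (ℤ.pos-* k j))) ⟨
    + (c ℕ.+ k ℕ.* j) - + k * + j     ≡⟨ cong (λ n → + n - + k * + j) eq ⟩
    + (q ℕ.* j ℕ.+ j) - + k * + j     ≡⟨ cong (_- + k * + j) (trans (ℤ.pos-+ (q ℕ.* j) j) (cong (_+ + j) (ℤ.pos-* q j))) ⟩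
    (+ q * + j + + j) - + k * + j     ≡⟨ factor (+ q) (+ j) (+ k) ⟩
    + j * (+ q + + 1 - + k)           ∎
    where
    cancel : ∀ c k j → c ≡ (c + k * j) - k * j
    cancel = solve-∀
    factor : ∀ q j k → (q * j + j) - k * j ≡ j * (q + + 1 - k)
    factor = solve-∀

open IntegerSums

module AlternatingSum (m : ℕ) (q : Fin m → ℕ) where
  open import Data.Integer using (_+_; _*_; _-_; -_; _^_)
  open ≡ using (refl; cong; cong₂; sym; trans)
  open ≡.≡-Reasoning

  ∏[q+1-k] : ℕ → ℤ
  ∏[q+1-k] k = ∏ m (λ i → + q i + + 1 - + k)

  term : ℕ → ℕ → ℕ → ℤ
  term l k t = (- + 1) ^ t * + (l C t) * ∏[q+1-k] (k ℕ.+ t)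

  alternating : ℕ → ℕ → ℤ
  alternating l k = sum< (suc l) (term l k)

  formula≡alternating : ∀ jR n → formula jR n m q ≡ + jR * alternating n 0
  formula≡alternating jR n = cong (λ x → + jR * x) (∑-toℕ (suc n) (term n 0))

  term-pascal : ∀ l k t → term (suc l) k (suc t) ≡ term l k (suc t) + - term l (suc k) t
  term-pascal l k t = begin
    - + 1 * s * + (suc l C suc t) * ∏[q+1-k] (k ℕ.+ suc t)
      ≡⟨ cong₂ (λ c n → - + 1 * s * + c * ∏[q+1-k] n) (sym (nCk+nC[k+1]≡[n+1]C[k+1] l t)) (ℕ.+-suc k t) ⟩
    - + 1 * s * + (l C t ℕ.+ l C suc t) * p
      ≡⟨ cong (λ c → - + 1 * s * c * p) (ℤ.pos-+ (l C t) (l C suc t)) ⟩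
    - + 1 * s * (+ (l C t) + + (l C suc t)) * p
      ≡⟨ distribute s (+ (l C t)) (+ (l C suc t)) p ⟩
    - + 1 * s * + (l C suc t) * p + - (s * + (l C t) * p)
      ≡⟨ cong (λ n → - + 1 * s * + (l C suc t) * ∏[q+1-k] n + - (s * + (l C t) * p)) (ℕ.+-suc k t) ⟨
    term l k (suc t) + - term l (suc k) t ∎
    where
    s p : ℤ
    s = (- + 1) ^ t
    p = ∏[q+1-k] (suc (k ℕ.+ t))
    distribute : ∀ s a b p → - + 1 * s * (a + b) * p ≡ - + 1 * s * b * p + - (s * a * p)
    distribute = solve-∀

  term-vanishes : ∀ l k → term l k (suc l) ≡ + 0
  term-vanishes l k = begin
    (- + 1) ^ suc l * + (l C suc l) * ∏[q+1-k] (k ℕ.+ suc l)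
      ≡⟨ cong (λ c → (- + 1) ^ suc l * + c * ∏[q+1-k] (k ℕ.+ suc l)) (k>n⇒nCk≡0 (ℕ.n<1+n l)) ⟩
    (- + 1) ^ suc l * + 0 * ∏[q+1-k] (k ℕ.+ suc l)
      ≡⟨ cong (_* ∏[q+1-k] (k ℕ.+ suc l)) (ℤ.*-zeroʳ ((- + 1) ^ suc l)) ⟩
    + 0 * ∏[q+1-k] (k ℕ.+ suc l)
      ≡⟨ ℤ.*-zeroˡ (∏[q+1-k] (k ℕ.+ suc l)) ⟩
    + 0 ∎

  alternating-pascal : ∀ l k → alternating (suc l) k ≡ alternating l k - alternating l (suc k)
  alternating-pascal l k = begin
    term l k 0 + sum< (suc l) (λ t → term (suc l) k (suc t))
      ≡⟨ cong (λ x → term l k 0 + x) (sum<-cong (suc l) (term-pascal l k)) ⟩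
    term l k 0 + sum< (suc l) (λ t → term l k (suc t) + - term l (suc k) t)
      ≡⟨ cong (λ x → term l k 0 + x) (sum<-+ (suc l) (λ t → term l k (suc t)) (λ t → - term l (suc k) t)) ⟩
    term l k 0 + (sum< (suc l) (λ t → term l k (suc t)) + sum< (suc l) (λ t → - term l (suc k) t))
      ≡⟨ cong (λ x → term l k 0 + (sum< (suc l) (λ t → term l k (suc t)) + x)) (sum<-neg (suc l) (term l (suc k))) ⟩
    term l k 0 + (sum< (suc l) (λ t → term l k (suc t)) - alternating l (suc k))
      ≡⟨ ℤ.+-assoc (term l k 0) _ _ ⟨
    sum< (suc (suc l)) (term l k) - alternating l (suc k)
      ≡⟨ cong (_- alternating l (suc k)) (sum<-last (suc l) (term l k)) ⟩
    alternating l k + term l k (suc l) - alternating l (suc k)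
      ≡⟨ cong (λ x → alternating l k + x - alternating l (suc k)) (term-vanishes l k) ⟩
    alternating l k + + 0 - alternating l (suc k)
      ≡⟨ cong (_- alternating l (suc k)) (ℤ.+-identityʳ (alternating l k)) ⟩
    alternating l k - alternating l (suc k) ∎

  alternating-zero : ∀ k → alternating 0 k ≡ ∏[q+1-k] k
  alternating-zero k = begin
    + 1 * + 1 * ∏[q+1-k] (k ℕ.+ 0) + + 0 ≡⟨ ℤ.+-identityʳ _ ⟩
    + 1 * + 1 * ∏[q+1-k] (k ℕ.+ 0)       ≡⟨ ℤ.*-identityˡ _ ⟩
    ∏[q+1-k] (k ℕ.+ 0)                   ≡⟨ cong ∏[q+1-k] (ℕ.+-identityʳ k) ⟩
    ∏[q+1-k] k                           ∎

  scaled-alternating-pascal : ∀ J l k → J * alternating (suc l) k ≡ J * alternating l k - J * alternating l (suc k)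
  scaled-alternating-pascal J l k = trans (cong (J *_) (alternating-pascal l k)) (distrib J _ _)
    where
    distrib : ∀ J x y → J * (x - y) ≡ J * x - J * y
    distrib = solve-∀

  product-count : ∀ {j c : Fin m → ℕ} k → (∀ i → c i ℕ.+ k ℕ.* j i ≡ q i ℕ.* j i ℕ.+ j i) →
    + ∏ℕ c ≡ + ∏ℕ j * alternating 0 k
  product-count {j} {c} k counts = begin
    + ∏ℕ c                                   ≡⟨ ∏ℕ-+ c ⟩
    ∏ m (λ i → + c i)                        ≡⟨ ∏-cong m (λ i → local-count (c i) k (j i) (q i) (counts i)) ⟩
    ∏ m (λ i → + j i * (+ q i + + 1 - + k))  ≡⟨ ∏-* m _ _ ⟩
    ∏ m (λ i → + j i) * ∏[q+1-k] k           ≡⟨ cong₂ _*_ (∏ℕ-+ j) (alternating-zero k) ⟨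
    + ∏ℕ j * alternating 0 k                 ∎

open import Data.Nat using (_≥_; _*_)

proposition5 :
    (R : CommutativeRing 0ℓ 0ℓ) →
    IsFinite R →
    ¬ (CommutativeRing._≈_ R (CommutativeRing.1# R) (CommutativeRing.0# R)) →
    (m : ℕ) (Rs : Fin m → CommutativeRing 0ℓ 0ℓ) →
    (∀ i → IsLocal (Rs i)) →
    (φ : CommutativeRing.Carrier R → (i : Fin m) → CommutativeRing.Carrier (Rs i)) →
    IsProductIso R Rs φ →
    (jR : ℕ) → CardOf (CommutativeRing.Carrier R) (CommutativeRing._≈_ R) (Jacobson R) jR →
    (j q : Fin m → ℕ) →
    (∀ i → CardOf (CommutativeRing.Carrier (Rs i)) (CommutativeRing._≈_ (Rs i)) (Jacobson (Rs i)) (j i)) →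
    (∀ i → CardOf (CommutativeRing.Carrier (Rs i)) (CommutativeRing._≈_ (Rs i)) (Total (Rs i)) (q i * j i)) →
    (n : ℕ) → n ≥ 1 →
    (ps : Fin n → Pair R) →
    (∀ i → Admissible R (ps i)) →
    (∀ i i′ → i ≢ i′ → Distant R (ps i) (ps i′)) →
    Σ ℕ λ N →
      CardOf (Pair R) (SameSub R) (InNbhdIntersection R ps) N ×
      (+ N ≡ formula jR n m q)
proposition5 R _ 1≉0 zero Rs _ φ iso _ _ _ _ _ _ _ _ _ _ _ =
  ⊥-elim (1≉0 (ProductRing.φ-injective R Rs φ iso _ _ λ ()))
proposition5 R (_ , R-finite) _ (suc m) Rs locals φ iso jR J-card j q J-cards Rs-finite n _ ps ps-admissible ps-distant =
  let N , N-card , N≡F = IE.count base (tabulate ps) [] [] (All.tabulate⁺ ps-admissible) []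
                           (AllPairs.tabulate⁺ λ {i} {i′} → ps-distant i i′) (All.tabulate⁺ λ _ → [])
  in N ,
     CardOf-cong (ℙ.SameSub-isEquivalence) (λ _ ((y-admissible , _) , ¬ps#y) → y-admissible , All.tabulate⁻ ¬ps#y)
       (λ _ (y-admissible , ¬ps#y) → (y-admissible , []) , All.tabulate⁺ ¬ps#y) N-card ,
     (begin
       + N                                             ≡⟨ N≡F ⟩
       + ∏ℕ j ℤ.* alternating (length (tabulate ps)) 0
         ≡⟨ ≡.cong₂ (λ J l → + J ℤ.* alternating l 0) (≡.sym jR≡∏j) (List.length-tabulate ps) ⟩
       + jR ℤ.* alternating n 0                        ≡⟨ formula≡alternating jR n ⟨
       formula jR n (suc m) q                          ∎)
  where
  open ≡.≡-Reasoning
  open AlternatingSum (suc m) q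
  module ℙ = ProjectiveLine R
  module P = ProductRing R Rs φ iso

  em : ExcludedMiddle 0ℓ
  em = LocalRing.em (Rs Fin.zero) (locals Fin.zero)

  module IE = InclusionExclusion R em (λ l k → + ∏ℕ j ℤ.* alternating l k) (scaled-alternating-pascal (+ ∏ℕ j))

  jR≡∏j : jR ≡ ∏ℕ j
  jR≡∏j = CardOf-unique (CommutativeRing.isEquivalence R) J-card (P.Jacobson-card em R-finite Rs-finite J-cards)

  base : ∀ qs → All (Admissible R) qs → AllPairs (Distant R) qs →
    ∃ λ N → CardOf (Pair R) (SameSub R) (ℙ.DistantToAll qs) N × + N ≡ + ∏ℕ j ℤ.* alternating 0 (length qs)
  base qs qs-admissible qs-distant =
    let cs , cs-card , cs-eq = P.DistantToAll-count locals Rs-finite J-cards qs qs-admissible qs-distant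
    in ∏ℕ cs , cs-card , product-count (length qs) cs-eq
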